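{- Let $f(x)=\sum_{n\ge1} q_n x^n$ be a formal power series over $\mathbb{C}$ with $q:=q_1\neq0$. For $s\in\mathbb{N}$ let $f^s$ be the $s$-fold compositional iterate of $f$ ($f^0(x)=x$), and for integers $0\le k\le n$ define $c_s(n,k)$ by $\frac{(f^s(x))^k}{k!}=\sum_{n\ge k} c_s(n,k)\frac{x^n}{n!}$. Then for $s\in\mathbb{N}$, \[ c_s(n,k)=\frac{n!}{k!}\sum_{\vec L\in\mathcal{P}_{n-k}} C(\vec L)\prod_{p=1}^{n-k} q_{p+1}^{L_p}, \] where \[ C(\vec L)=\sum_{\vec\ell_1+\cdots+\vec\ell_s=\vec L} q^{\sum_{t=1}^s (s-t)\langle\vec\ell_t\rangle+sk-|\vec L|}\prod_{i=1}^{s}\binom{\sum_{t=1}^{i-1}\langle\vec\ell_t\rangle+k}{\vec\ell_i,\ \sum_{t=1}^{i-1}\langle\vec\ell_t\rangle+k-|\vec\ell_i|}, \] the sum running over all $s$-tuples $(\vec\ell_1,\ldots,\vec\ell_s)$ of finitely supported sequences in $\mathbb{N}^{\mathbb{N}^*}$ whose componentwise sum is $\vec L$.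
   Context: For $m\in\mathbb{N}$, $\mathcal{P}_m$ is the set of sequences $\vec\ell=(\ell_1,\ell_2,\ldots)\in\mathbb{N}^{\mathbb{N}^*}$ with $\ell_p=0$ for $p>m$ and $\sum_p p\ell_p=m$. For a finitely supported $\vec\ell$, $|\vec\ell|:=\sum_p \ell_p$ and $\langle\vec\ell\rangle:=\sum_p p\,\ell_p$. For $M\in\mathbb{N}$, the multinomial coefficient $\binom{M}{\vec\lambda,\,M-|\vec\lambda|}$ denotes $\frac{M!}{\left(\prod_p \lambda_p!\right)(M-|\vec\lambda|)!}$, taken to be $0$ when $M-|\vec\lambda|<0$. -}

module Defs where

open import Level using (Level)
open import Algebra.Bundles using (CommutativeRing)
open import Data.Bool using (if_then_else_)
open import Data.Nat as ℕ using (ℕ; zero; suc; _∸_; _≤ᵇ_; _!; NonZero)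
open import Data.Nat.Properties using (_!≢0; m*n≢0)
open import Data.Vec as V using (Vec; []; _∷_)
open import Data.Vec.Properties using (≡-dec)
open import Data.List as L using (List; []; _∷_; [_])
open import Relation.Nullary.Decidable using (does)

-- Purely combinatorial (ℕ-valued) notions.
-- A finitely supported sequence ℓ = (ℓ₁, ℓ₂, …) with ℓ_p = 0 for p > m is
-- represented by the vector (ℓ₁, …, ℓ_m) : Vec ℕ m.

weighted : ∀ {m} → ℕ → Vec ℕ m → ℕ
weighted i []       = 0
weighted i (x ∷ xs) = i ℕ.* x ℕ.+ weighted (suc i) xs

⟨_⟩ : ∀ {m} → Vec ℕ m → ℕ
⟨ v ⟩ = weighted 1 v

∣_∣ : ∀ {m} → Vec ℕ m → ℕ
∣ v ∣ = V.sum v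

box : (m B : ℕ) → List (Vec ℕ m)
box zero    B = [ [] ]
box (suc m) B = L.concatMap (λ x → L.map (x ∷_) (box m B)) (L.upTo (suc B))

-- 𝒫_m : sequences supported in {1..m} with Σ p ℓ_p = m
-- (every such ℓ has ℓ_p ≤ m, so filtering box m m enumerates 𝒫_m exactly)
𝒫 : (m : ℕ) → List (Vec ℕ m)
𝒫 m = L.filter (λ v → ⟨ v ⟩ ℕ.≟ m) (box m m)

vsum : ∀ {m} → List (Vec ℕ m) → Vec ℕ m
vsum []       = V.replicate _ 0
vsum (v ∷ vs) = V.zipWith ℕ._+_ v (vsum vs)

tuplesOf : ∀ {a} {A : Set a} → ℕ → List A → List (List A)
tuplesOf zero    xs = [ [] ]
tuplesOf (suc s) xs = L.concatMap (λ x → L.map (x ∷_) (tuplesOf s xs)) xs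

-- all s-tuples (ℓ₁,…,ℓ_s) of finitely supported sequences with ℓ₁+⋯+ℓ_s = L.
-- (Each ℓ_t is then supported in {1..m} with entries ≤ |L|.)
decomps : ∀ {m} → (s : ℕ) → Vec ℕ m → List (List (Vec ℕ m))
decomps {m} s Lv =
  L.filter (λ ts → ≡-dec ℕ._≟_ (vsum ts) Lv) (tuplesOf s (box m ∣ Lv ∣))

prod! : ∀ {m} → Vec ℕ m → ℕ
prod! []       = 1
prod! (x ∷ xs) = (x !) ℕ.* prod! xs

prod!≢0 : ∀ {m} (v : Vec ℕ m) → NonZero (prod! v)
prod!≢0 []       = _
prod!≢0 (x ∷ xs) = m*n≢0 (x !) (prod! xs) {{x !≢0}} {{prod!≢0 xs}}

multinom : ∀ {m} → ℕ → Vec ℕ m → ℕ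
multinom M λv =
  if ∣ λv ∣ ≤ᵇ M
  then (M ! ℕ./ (prod! λv ℕ.* (M ∸ ∣ λv ∣) !))
         {{m*n≢0 (prod! λv) ((M ∸ ∣ λv ∣) !) {{prod!≢0 λv}} {{(M ∸ ∣ λv ∣) !≢0}}}}
  else 0

-- Π_{i} ( Σ_{t<i} ⟨ℓ_t⟩ + k  choose  ℓ_i , Σ_{t<i} ⟨ℓ_t⟩ + k - |ℓ_i| ),
-- first argument = accumulator k + Σ_{t<i} ⟨ℓ_t⟩
multProd : ∀ {m} → ℕ → List (Vec ℕ m) → ℕ
multProd acc []       = 1
multProd acc (ℓ ∷ ts) = multinom acc ℓ ℕ.* multProd (acc ℕ.+ ⟨ ℓ ⟩) ts

-- Σ_{t=1}^{s} (s - t) ⟨ℓ_t⟩   (s - t = number of entries after ℓ_t)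
wsum : ∀ {m} → List (Vec ℕ m) → ℕ
wsum []       = 0
wsum (ℓ ∷ ts) = L.length ts ℕ.* ⟨ ℓ ⟩ ℕ.+ wsum ts

module _ {c ℓ} (R : CommutativeRing c ℓ) where
  open CommutativeRing R

  Series : Set c
  Series = ℕ → Carrier

  fromℕ : ℕ → Carrier
  fromℕ zero    = 0#
  fromℕ (suc n) = 1# + fromℕ n

  _^^_ : Carrier → ℕ → Carrier
  x ^^ zero  = 1#
  x ^^ suc n = x * (x ^^ n)

  sumUpTo : ℕ → (ℕ → Carrier) → Carrier
  sumUpTo zero    g = g 0
  sumUpTo (suc n) g = sumUpTo n g + g (suc n)

  sumList : ∀ {a} {A : Set a} → List A → (A → Carrier) → Carrier
  sumList []       g = 0#
  sumList (x ∷ xs) g = g x + sumList xs g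

  mulS : Series → Series → Series
  mulS a b n = sumUpTo n (λ i → a i * b (n ∸ i))

  oneS : Series
  oneS zero    = 1#
  oneS (suc n) = 0#

  powS : Series → ℕ → Series
  powS a zero    = oneS
  powS a (suc j) = mulS a (powS a j)

  -- composition g ∘ h, for h with zero constant term
  compS : Series → Series → Series
  compS g h n = sumUpTo n (λ j → g j * powS h j n)

  xS : Series
  xS zero          = 0#
  xS (suc zero)    = 1#
  xS (suc (suc n)) = 0#

  -- f(x) = Σ_{n≥1} q_n x^n  built from q : ℕ → Carrier (q 0 is ignored)
  seriesOf : (ℕ → Carrier) → Series
  seriesOf q zero    = 0#
  seriesOf q (suc n) = q (suc n)

  iterS : Series → ℕ → Series
  iterS f zero    = xS
  iterS f (suc s) = compS f (iterS f s)

  -- c_s(n,k) : (f^s(x))^k / k! = Σ_n c_s(n,k) x^n / n!,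
  -- i.e. c_s(n,k) = (n!/k!) [x^n] (f^s)^k
  cCoeff : (ℕ → Carrier) → (s n k : ℕ) → Carrier
  cCoeff q s n k =
    fromℕ ((n ! ℕ./ k !) {{k !≢0}}) * powS (iterS (seriesOf q) s) k n

  qProd : (ℕ → Carrier) → ∀ {m} → ℕ → Vec ℕ m → Carrier
  qProd q p []       = 1#
  qProd q p (x ∷ xs) = (q (suc p) ^^ x) * qProd q (suc p) xs

  CL : (ℕ → Carrier) → (s k : ℕ) → ∀ {m} → Vec ℕ m → Carrier
  CL q s k Lv = sumList (decomps s Lv) λ ts →
    (q 1 ^^ ((wsum ts ℕ.+ s ℕ.* k) ∸ ∣ Lv ∣)) * fromℕ (multProd k ts)

  rhs : (ℕ → Carrier) → (s n k : ℕ) → Carrier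
  rhs q s n k =
    fromℕ ((n ! ℕ./ k !) {{k !≢0}})
      * sumList (𝒫 (n ∸ k)) (λ Lv → CL q s k Lv * qProd q 1 Lv)

-- For a series w = w₁x + w₂x² + ⋯, the coefficient of x^(k+t) in w^k is a sum over vectors ℓ of
-- total excess degree Σ_p p ℓ_p = t of the multinomial coefficient (k; ℓ, k - |ℓ|) times
-- w₁^(k-|ℓ|) Π_p w_{p+1}^{ℓ_p}; this follows by splitting off one monomial at a time and applying
-- the binomial theorem. Since (f ∘ g)^k = f^k ∘ g, the coefficient of x^(k+m) in (f^(s+1))^k
-- splits along the outermost copy of f into one such vector ℓ₁ and the same problem for f^s with
-- k + ⟨ℓ₁⟩ in place of k. Iterating yields the tuples (ℓ₁, …, ℓ_s) of the theorem; grouping them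
-- by their sum L gives C(L), the product of the factors q_{p+1}^{ℓ_{t,p}} being Π_p q_{p+1}^{L_p}.

module Submission where

open import Algebra.Bundles using (CommutativeRing; CommutativeSemiring)
open import Algebra.Structures using (IsCommutativeSemiring)
open import Data.Bool using (Bool; true; false; T; _∧_; not)
open import Data.Bool.Properties using (T-≡; ∧-zeroʳ)
open import Data.Empty using (⊥-elim)
open import Data.List as List using (List; []; _∷_)
open import Data.Nat as ℕ using (ℕ; zero; suc; _≤_; _<_; z≤n; s≤s; _∸_; _!; _≤ᵇ_; _≡ᵇ_)
import Data.Nat.Properties as ℕₚ
open import Data.Nat.Combinatorics using (_C_; k![n∸k]!∣n!; nCk≡n!/k![n-k]!; k>n⇒nCk≡0)
open import Data.Nat.DivMod using (m*n/n≡m; m/n*n≡m; /-congˡ)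
open import Data.Nat.ListAction using (sum)
open import Data.Nat.Tactic.RingSolver using (solve-∀)
open import Data.Product using (_×_; _,_; proj₁; proj₂)
open import Data.Unit using (tt)
open import Data.Vec as Vec using (Vec; []; _∷_)
open import Data.Vec.Properties using (≡-dec)
open import Function.Bundles using (Equivalence)
open import Relation.Nullary using (¬_; Dec; does; yes; no)
import Relation.Binary.PropositionalEquality as ≡
open ≡ using (_≡_; _≢_)

open import Defs

module Multinomial where
  open ≡ using (refl; sym; trans; cong; cong₂; subst; module ≡-Reasoning)
  open import Data.Nat using (_+_; _*_)

  binomialProduct : ∀ {m} → ℕ → Vec ℕ m → ℕ
  binomialProduct M []      = 1
  binomialProduct M (y ∷ v) = (M C y) * binomialProduct (M ∸ y) v

  n!≡nCk*[k!*[n∸k]!] : ∀ {n k} → k ≤ n → n ! ≡ (n C k) * (k ! * (n ∸ k) !)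
  n!≡nCk*[k!*[n∸k]!] {n} {k} k≤n = sym (begin
    (n C k) * d         ≡⟨ cong (_* d) (nCk≡n!/k![n-k]! k≤n) ⟩
    (n ! ℕ./ d) * d     ≡⟨ m/n*n≡m (k![n∸k]!∣n! k≤n) ⟩
    n !                 ∎)
    where
    open ≡-Reasoning
    d = k ! * (n ∸ k) !
    instance _ = k ℕₚ.!* (n ∸ k) !≢0

  M!≡binomialProduct*denominator : ∀ {m} M (v : Vec ℕ m) → ∣ v ∣ ≤ M →
                                   M ! ≡ binomialProduct M v * (prod! v * (M ∸ ∣ v ∣) !)
  M!≡binomialProduct*denominator M []      _  = sym (trans (ℕₚ.*-identityˡ _) (ℕₚ.*-identityˡ _))
  M!≡binomialProduct*denominator M (y ∷ v) le = begin
    M !                                                    ≡⟨ n!≡nCk*[k!*[n∸k]!] y≤M ⟩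
    (M C y) * (y ! * (M ∸ y) !)                            ≡⟨ cong (λ z → (M C y) * (y ! * z)) ih ⟩
    (M C y) * (y ! * (P * (prod! v * (M ∸ y ∸ ∣ v ∣) !)))  ≡⟨ regroup (M C y) (y !) P (prod! v) _ ⟩
    ((M C y) * P) * ((y ! * prod! v) * (M ∸ y ∸ ∣ v ∣) !)
      ≡⟨ cong (λ z → ((M C y) * P) * ((y ! * prod! v) * z !)) (ℕₚ.∸-+-assoc M y ∣ v ∣) ⟩
    ((M C y) * P) * ((y ! * prod! v) * (M ∸ (y + ∣ v ∣)) !) ∎
    where
    open ≡-Reasoning
    P = binomialProduct (M ∸ y) v
    y≤M : y ≤ M
    y≤M = ℕₚ.≤-trans (ℕₚ.m≤m+n y ∣ v ∣) le
    ih : (M ∸ y) ! ≡ P * (prod! v * (M ∸ y ∸ ∣ v ∣) !)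
    ih = M!≡binomialProduct*denominator (M ∸ y) v
           (subst (_≤ M ∸ y) (ℕₚ.m+n∸m≡n y ∣ v ∣) (ℕₚ.∸-monoˡ-≤ y le))
    regroup : ∀ c y t p r → c * (y * (t * (p * r))) ≡ (c * t) * ((y * p) * r)
    regroup = solve-∀

  binomialProduct-vanishes : ∀ {m} M (v : Vec ℕ m) → M < ∣ v ∣ → binomialProduct M v ≡ 0
  binomialProduct-vanishes M (y ∷ v) M<∣y∷v∣ with y ℕ.≤? M
  ... | no  y≰M = cong (_* binomialProduct (M ∸ y) v) (k>n⇒nCk≡0 (ℕₚ.≰⇒> y≰M))
  ... | yes y≤M = trans (cong ((M C y) *_) (binomialProduct-vanishes (M ∸ y) v M∸y<∣v∣))
                        (ℕₚ.*-zeroʳ (M C y))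
    where
    M∸y<∣v∣ : M ∸ y < ∣ v ∣
    M∸y<∣v∣ = ℕₚ.+-cancelˡ-< y (M ∸ y) ∣ v ∣
                (subst (_< y + ∣ v ∣) (sym (ℕₚ.m+[n∸m]≡n y≤M)) M<∣y∷v∣)

  binomialProduct≢0⇒∣v∣≤M : ∀ {m} M (v : Vec ℕ m) → binomialProduct M v ≢ 0 → ∣ v ∣ ≤ M
  binomialProduct≢0⇒∣v∣≤M M v ≢0 with ∣ v ∣ ℕ.≤? M
  ... | yes ∣v∣≤M = ∣v∣≤M
  ... | no  ∣v∣≰M = ⊥-elim (≢0 (binomialProduct-vanishes M v (ℕₚ.≰⇒> ∣v∣≰M)))

  multinom≡binomialProduct : ∀ {m} M (v : Vec ℕ m) → multinom M v ≡ binomialProduct M v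
  multinom≡binomialProduct M v with ∣ v ∣ ≤ᵇ M in eq
  ... | true  = trans (/-congˡ (M!≡binomialProduct*denominator M v ∣v∣≤M)) (m*n/n≡m _ _)
    where
    ∣v∣≤M = ℕₚ.≤ᵇ⇒≤ ∣ v ∣ M (subst T (sym eq) tt)
    instance _ = ℕₚ.m*n≢0 (prod! v) ((M ∸ ∣ v ∣) !) {{prod!≢0 v}} {{(M ∸ ∣ v ∣) ℕₚ.!≢0}}
  ... | false = sym (binomialProduct-vanishes M v (ℕₚ.≰⇒> λ le → subst T eq (ℕₚ.≤⇒≤ᵇ le)))

module TupleStatistics where
  open ≡ using (refl; sym; trans; cong; cong₂; subst; module ≡-Reasoning)
  open import Data.Nat using (_+_; _*_)
  open Multinomial

  Σ⟨_⟩ : ∀ {m} → List (Vec ℕ m) → ℕ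
  Σ⟨ ts ⟩ = sum (List.map ⟨_⟩ ts)

  Σ∣_∣ : ∀ {m} → List (Vec ℕ m) → ℕ
  Σ∣ ts ∣ = sum (List.map ∣_∣ ts)

  ∣zipWith+∣ : ∀ {m} (u v : Vec ℕ m) → ∣ Vec.zipWith _+_ u v ∣ ≡ ∣ u ∣ + ∣ v ∣
  ∣zipWith+∣ []      []      = refl
  ∣zipWith+∣ (x ∷ u) (y ∷ v) = trans (cong ((x + y) +_) (∣zipWith+∣ u v)) (interchange x y ∣ u ∣ ∣ v ∣)
    where
    interchange : ∀ a b c d → (a + b) + (c + d) ≡ (a + c) + (b + d)
    interchange = solve-∀

  weighted-zipWith+ : ∀ {m} i (u v : Vec ℕ m) →
                      weighted i (Vec.zipWith _+_ u v) ≡ weighted i u + weighted i v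
  weighted-zipWith+ i []      []      = refl
  weighted-zipWith+ i (x ∷ u) (y ∷ v) =
    trans (cong (i * (x + y) +_) (weighted-zipWith+ (suc i) u v)) (distribute i x y _ _)
    where
    distribute : ∀ i a b c d → i * (a + b) + (c + d) ≡ (i * a + c) + (i * b + d)
    distribute = solve-∀

  ∣replicate0∣ : ∀ m → ∣ Vec.replicate m 0 ∣ ≡ 0
  ∣replicate0∣ zero    = refl
  ∣replicate0∣ (suc m) = ∣replicate0∣ m

  weighted-replicate0 : ∀ m i → weighted i (Vec.replicate m 0) ≡ 0
  weighted-replicate0 zero    i = refl
  weighted-replicate0 (suc m) i =
    trans (cong (_+ weighted (suc i) (Vec.replicate m 0)) (ℕₚ.*-zeroʳ i)) (weighted-replicate0 m (suc i))

  ∣vsum∣≡Σ∣∣ : ∀ m (ts : List (Vec ℕ m)) → ∣ vsum ts ∣ ≡ Σ∣ ts ∣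
  ∣vsum∣≡Σ∣∣ m []       = ∣replicate0∣ m
  ∣vsum∣≡Σ∣∣ m (v ∷ ts) = trans (∣zipWith+∣ v (vsum ts)) (cong (∣ v ∣ +_) (∣vsum∣≡Σ∣∣ m ts))

  ⟨vsum⟩≡Σ⟨⟩ : ∀ m (ts : List (Vec ℕ m)) → ⟨ vsum ts ⟩ ≡ Σ⟨ ts ⟩
  ⟨vsum⟩≡Σ⟨⟩ m []       = weighted-replicate0 m 1
  ⟨vsum⟩≡Σ⟨⟩ m (v ∷ ts) = trans (weighted-zipWith+ 1 v (vsum ts)) (cong (⟨ v ⟩ +_) (⟨vsum⟩≡Σ⟨⟩ m ts))

  ∣v∣≤weighted : ∀ {m} i (v : Vec ℕ m) → 1 ≤ i → ∣ v ∣ ≤ weighted i v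
  ∣v∣≤weighted i       []      _       = z≤n
  ∣v∣≤weighted (suc i) (x ∷ v) (s≤s _) =
    ℕₚ.+-mono-≤ (ℕₚ.m≤m+n x (i * x)) (∣v∣≤weighted (suc (suc i)) v (s≤s z≤n))

  ∣v∣≤⟨v⟩ : ∀ {m} (v : Vec ℕ m) → ∣ v ∣ ≤ ⟨ v ⟩
  ∣v∣≤⟨v⟩ v = ∣v∣≤weighted 1 v (s≤s z≤n)

  bounded : ∀ {m} → ℕ → Vec ℕ m → Bool
  bounded B []      = true
  bounded B (x ∷ v) = (x ≤ᵇ B) ∧ bounded B v

  allBounded : ∀ {m} → ℕ → List (Vec ℕ m) → Bool
  allBounded B []       = true
  allBounded B (v ∷ ts) = bounded B v ∧ allBounded B ts

  ≤⇒≤ᵇ≡true : ∀ {x B} → x ≤ B → (x ≤ᵇ B) ≡ true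
  ≤⇒≤ᵇ≡true x≤B = Equivalence.to T-≡ (ℕₚ.≤⇒≤ᵇ x≤B)

  >⇒≤ᵇ≡false : ∀ {x B} → B < x → (x ≤ᵇ B) ≡ false
  >⇒≤ᵇ≡false {x} {B} B<x with x ≤ᵇ B in eq
  ... | false = refl
  ... | true  = ⊥-elim (ℕₚ.<⇒≱ B<x (ℕₚ.≤ᵇ⇒≤ x B (subst T (sym eq) tt)))

  bounded-∣∣ : ∀ {m} B (v : Vec ℕ m) → ∣ v ∣ ≤ B → bounded B v ≡ true
  bounded-∣∣ B []      _  = refl
  bounded-∣∣ B (x ∷ v) le = cong₂ _∧_ (≤⇒≤ᵇ≡true (ℕₚ.≤-trans (ℕₚ.m≤m+n x ∣ v ∣) le))
                                      (bounded-∣∣ B v (ℕₚ.≤-trans (ℕₚ.m≤n+m ∣ v ∣ x) le))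

  allBounded-∣vsum∣ : ∀ {m} B (ts : List (Vec ℕ m)) → ∣ vsum ts ∣ ≤ B → allBounded B ts ≡ true
  allBounded-∣vsum∣ B []       _  = refl
  allBounded-∣vsum∣ B (v ∷ ts) le = cong₂ _∧_ (bounded-∣∣ B v (ℕₚ.≤-trans (ℕₚ.m≤m+n ∣ v ∣ _) le′))
                                               (allBounded-∣vsum∣ B ts (ℕₚ.≤-trans (ℕₚ.m≤n+m _ ∣ v ∣) le′))
    where le′ = subst (_≤ B) (∣zipWith+∣ v (vsum ts)) le

  -- the exponent of q₁ in C(L), for a tuple read from the accumulator acc (= k initially)
  qExponent : ∀ {m} → ℕ → List (Vec ℕ m) → ℕ
  qExponent acc ts = (wsum ts + List.length ts * acc) ∸ Σ∣ ts ∣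

  multProd-∷≢0 : ∀ {m} acc (v : Vec ℕ m) ts → multProd acc (v ∷ ts) ≢ 0 →
                 binomialProduct acc v ≢ 0 × multProd (acc + ⟨ v ⟩) ts ≢ 0
  multProd-∷≢0 acc v ts ≢0 =
      (λ e → ≢0 (cong (_* multProd (acc + ⟨ v ⟩) ts) (trans (multinom≡binomialProduct acc v) e)))
    , (λ e → ≢0 (trans (cong (multinom acc v *_) e) (ℕₚ.*-zeroʳ (multinom acc v))))

  wsum-∷-shift : ∀ {m} acc (v : Vec ℕ m) ts →
                 wsum (v ∷ ts) + List.length (v ∷ ts) * acc ≡ acc + (wsum ts + List.length ts * (acc + ⟨ v ⟩))
  wsum-∷-shift acc v ts = shift (List.length ts) ⟨ v ⟩ (wsum ts) acc
    where
    shift : ∀ n l w a → (n * l + w) + suc n * a ≡ a + (w + n * (a + l))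
    shift = solve-∀

  multProd≢0⇒Σ∣∣≤ : ∀ {m} acc (ts : List (Vec ℕ m)) → multProd acc ts ≢ 0 →
                    Σ∣ ts ∣ ≤ wsum ts + List.length ts * acc
  multProd≢0⇒Σ∣∣≤ acc []       _  = z≤n
  multProd≢0⇒Σ∣∣≤ acc (v ∷ ts) ≢0 =
    subst (Σ∣ v ∷ ts ∣ ≤_) (sym (wsum-∷-shift acc v ts))
      (ℕₚ.+-mono-≤ (binomialProduct≢0⇒∣v∣≤M acc v head≢0) (multProd≢0⇒Σ∣∣≤ (acc + ⟨ v ⟩) ts tail≢0))
    where
    head≢0 = proj₁ (multProd-∷≢0 acc v ts ≢0)
    tail≢0 = proj₂ (multProd-∷≢0 acc v ts ≢0)

  [m+n]∸[o+p]≡[m∸o]+[n∸p] : ∀ m n o p → o ≤ m → p ≤ n → (m + n) ∸ (o + p) ≡ (m ∸ o) + (n ∸ p)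
  [m+n]∸[o+p]≡[m∸o]+[n∸p] m n o p o≤m p≤n = begin
    (m + n) ∸ (o + p) ≡⟨ sym (ℕₚ.∸-+-assoc (m + n) o p) ⟩
    (m + n) ∸ o ∸ p   ≡⟨ cong (_∸ p) (ℕₚ.+-∸-comm n o≤m) ⟩
    (m ∸ o + n) ∸ p   ≡⟨ ℕₚ.+-∸-assoc (m ∸ o) p≤n ⟩
    (m ∸ o) + (n ∸ p) ∎
    where open ≡-Reasoning

  qExponent-∷ : ∀ {m} acc (v : Vec ℕ m) ts → multProd acc (v ∷ ts) ≢ 0 →
                qExponent acc (v ∷ ts) ≡ (acc ∸ ∣ v ∣) + qExponent (acc + ⟨ v ⟩) ts
  qExponent-∷ acc v ts ≢0 =
    trans (cong (_∸ (∣ v ∣ + Σ∣ ts ∣)) (wsum-∷-shift acc v ts))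
          ([m+n]∸[o+p]≡[m∸o]+[n∸p] acc _ ∣ v ∣ Σ∣ ts ∣
             (binomialProduct≢0⇒∣v∣≤M acc v head≢0) (multProd≢0⇒Σ∣∣≤ (acc + ⟨ v ⟩) ts tail≢0))
    where
    head≢0 = proj₁ (multProd-∷≢0 acc v ts ≢0)
    tail≢0 = proj₂ (multProd-∷≢0 acc v ts ≢0)

module FiniteSums {c ℓ} (R : CommutativeRing c ℓ) where
  open CommutativeRing R hiding (zero)
  open import Relation.Binary.Reasoning.Setoid setoid
  open import Algebra.Properties.CommutativeSemigroup +-commutativeSemigroup
    using () renaming (interchange to +-interchange)

  Σ≤ : ℕ → (ℕ → Carrier) → Carrier
  Σ≤ = sumUpTo R

  Σ∈ : ∀ {a} {A : Set a} → List A → (A → Carrier) → Carrier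
  Σ∈ = sumList R

  [_]·_ : Bool → Carrier → Carrier
  [ true  ]· x = x
  [ false ]· x = 0#

  infixr 8 [_]·_

  []·-cong : ∀ b {x y} → x ≈ y → [ b ]· x ≈ [ b ]· y
  []·-cong true  x≈y = x≈y
  []·-cong false _   = refl

  []·-*ˡ : ∀ b x y → x * [ b ]· y ≈ [ b ]· (x * y)
  []·-*ˡ true  x y = refl
  []·-*ˡ false x y = zeroʳ x

  []·-*ʳ : ∀ b x y → [ b ]· x * y ≈ [ b ]· (x * y)
  []·-*ʳ true  x y = refl
  []·-*ʳ false x y = zeroˡ y

  []·-∧ : ∀ a b x → [ a ∧ b ]· x ≈ [ a ]· [ b ]· x
  []·-∧ true  b x = refl
  []·-∧ false b x = refl

  []·-zero : ∀ b {x} → x ≈ 0# → [ b ]· x ≈ 0#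
  []·-zero true  x≈0 = x≈0
  []·-zero false _   = refl

  []·-yes : ∀ {p} {P : Set p} (P? : Dec P) x → P → [ does P? ]· x ≈ x
  []·-yes (yes _) x _ = refl
  []·-yes (no ¬p) x p = ⊥-elim (¬p p)

  []·-no : ∀ {p} {P : Set p} (P? : Dec P) x → ¬ P → [ does P? ]· x ≈ 0#
  []·-no (yes p) x ¬p = ⊥-elim (¬p p)
  []·-no (no _)  x _  = refl

  []·-cong-dec : ∀ {p} {P : Set p} (P? : Dec P) {x y} → (P → x ≈ y) → [ does P? ]· x ≈ [ does P? ]· y
  []·-cong-dec (yes p) x≈y = x≈y p
  []·-cong-dec (no _)  _   = refl

  []·-comm : ∀ a b x → [ a ]· [ b ]· x ≈ [ b ]· [ a ]· x
  []·-comm true  b x = refl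
  []·-comm false b x = sym ([]·-zero b refl)

  []·-≤-≡∸ : ∀ d e n x → [ d ≤ᵇ n ]· [ e ≡ᵇ n ∸ d ]· x ≈ [ d ℕ.+ e ≡ᵇ n ]· x
  []·-≤-≡∸ d e n x = go (d ℕ.≤? n) (e ℕ.≟ n ∸ d) (d ℕ.+ e ℕ.≟ n)
    where
    go : (d≤?n : Dec (d ≤ n)) (e≟n∸d : Dec (e ≡ n ∸ d)) (d+e≟n : Dec (d ℕ.+ e ≡ n)) →
         [ does d≤?n ]· [ does e≟n∸d ]· x ≈ [ does d+e≟n ]· x
    go (yes _)   (yes _)      (yes _)      = refl
    go (yes d≤n) (yes ≡.refl) (no ≢n)      = ⊥-elim (≢n (ℕₚ.m+[n∸m]≡n d≤n))
    go (yes _)   (no ≢)       (yes ≡.refl) = ⊥-elim (≢ (≡.sym (ℕₚ.m+n∸m≡n d e)))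
    go (yes _)   (no _)       (no _)       = refl
    go (no d≰n)  _            (yes ≡.refl) = ⊥-elim (d≰n (ℕₚ.m≤m+n d e))
    go (no _)    _            (no _)       = refl

  Σ≤-cong : ∀ n {f g : ℕ → Carrier} → (∀ i → i ≤ n → f i ≈ g i) → Σ≤ n f ≈ Σ≤ n g
  Σ≤-cong zero    f≈g = f≈g 0 z≤n
  Σ≤-cong (suc n) f≈g = +-cong (Σ≤-cong n λ i i≤n → f≈g i (ℕₚ.m≤n⇒m≤1+n i≤n)) (f≈g (suc n) ℕₚ.≤-refl)

  Σ≤-+ : ∀ n (f g : ℕ → Carrier) → Σ≤ n (λ i → f i + g i) ≈ Σ≤ n f + Σ≤ n g
  Σ≤-+ zero    f g = refl
  Σ≤-+ (suc n) f g = trans (+-congʳ (Σ≤-+ n f g)) (+-interchange _ _ _ _)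

  *-distribˡ-Σ≤ : ∀ n x (f : ℕ → Carrier) → x * Σ≤ n f ≈ Σ≤ n (λ i → x * f i)
  *-distribˡ-Σ≤ zero    x f = refl
  *-distribˡ-Σ≤ (suc n) x f = trans (distribˡ _ _ _) (+-congʳ (*-distribˡ-Σ≤ n x f))

  *-distribʳ-Σ≤ : ∀ n x (f : ℕ → Carrier) → Σ≤ n f * x ≈ Σ≤ n (λ i → f i * x)
  *-distribʳ-Σ≤ zero    x f = refl
  *-distribʳ-Σ≤ (suc n) x f = trans (distribʳ _ _ _) (+-congʳ (*-distribʳ-Σ≤ n x f))

  Σ≤-zero : ∀ n {f : ℕ → Carrier} → (∀ i → i ≤ n → f i ≈ 0#) → Σ≤ n f ≈ 0#
  Σ≤-zero zero    f≈0 = f≈0 0 z≤n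
  Σ≤-zero (suc n) f≈0 =
    trans (+-cong (Σ≤-zero n λ i i≤n → f≈0 i (ℕₚ.m≤n⇒m≤1+n i≤n)) (f≈0 (suc n) ℕₚ.≤-refl)) (+-identityˡ 0#)

  Σ≤-suc : ∀ n (f : ℕ → Carrier) → Σ≤ (suc n) f ≈ f 0 + Σ≤ n (λ i → f (suc i))
  Σ≤-suc zero    f = refl
  Σ≤-suc (suc n) f = trans (+-congʳ (Σ≤-suc n f)) (+-assoc _ _ _)

  Σ≤-extend : ∀ n N (f : ℕ → Carrier) → n ≤ N → (∀ i → n < i → f i ≈ 0#) → Σ≤ N f ≈ Σ≤ n f
  Σ≤-extend n N f n≤N f≈0 = ≡.subst (λ z → Σ≤ z f ≈ Σ≤ n f) (ℕₚ.m∸n+n≡m n≤N) (extend (N ∸ n))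
    where
    extend : ∀ k → Σ≤ (k ℕ.+ n) f ≈ Σ≤ n f
    extend zero    = refl
    extend (suc k) = trans (+-congʳ (extend k))
                           (trans (+-congˡ (f≈0 _ (s≤s (ℕₚ.m≤n+m n k)))) (+-identityʳ _))

  Σ≤-extend₂ : ∀ n m {f g : ℕ → Carrier} → (∀ i → f i ≈ g i) →
               (∀ i → n < i → f i ≈ 0#) → (∀ i → m < i → g i ≈ 0#) → Σ≤ n f ≈ Σ≤ m g
  Σ≤-extend₂ n m {f} {g} f≈g f≈0 g≈0 = begin
    Σ≤ n f         ≈⟨ Σ≤-extend n (n ℕ.+ m) f (ℕₚ.m≤m+n n m) f≈0 ⟨
    Σ≤ (n ℕ.+ m) f ≈⟨ Σ≤-cong (n ℕ.+ m) (λ i _ → f≈g i) ⟩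
    Σ≤ (n ℕ.+ m) g ≈⟨ Σ≤-extend m (n ℕ.+ m) g (ℕₚ.m≤n+m m n) g≈0 ⟩
    Σ≤ m g         ∎

  Σ≤-drop : ∀ k m (f : ℕ → Carrier) → (∀ i → i < k → f i ≈ 0#) → Σ≤ (k ℕ.+ m) f ≈ Σ≤ m (λ t → f (k ℕ.+ t))
  Σ≤-drop zero    m f f≈0 = refl
  Σ≤-drop (suc k) m f f≈0 = begin
    Σ≤ (suc (k ℕ.+ m)) f                     ≈⟨ Σ≤-suc (k ℕ.+ m) f ⟩
    f 0 + Σ≤ (k ℕ.+ m) (λ i → f (suc i))     ≈⟨ +-cong (f≈0 0 (s≤s z≤n))
                                                  (Σ≤-drop k m (λ i → f (suc i)) λ i i<k → f≈0 (suc i) (s≤s i<k)) ⟩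
    0# + Σ≤ m (λ t → f (suc (k ℕ.+ t)))      ≈⟨ +-identityˡ _ ⟩
    Σ≤ m (λ t → f (suc k ℕ.+ t))             ∎

  Σ≤-select : ∀ m a (h : ℕ → Carrier) → Σ≤ m (λ t → [ a ≡ᵇ t ]· h t) ≈ [ a ≤ᵇ m ]· h a
  Σ≤-select zero    a h = go (a ℕ.≟ 0) (a ℕ.≤? 0)
    where
    go : (a≟0 : Dec (a ≡ 0)) (a≤?0 : Dec (a ≤ 0)) → [ does a≟0 ]· h 0 ≈ [ does a≤?0 ]· h a
    go (yes ≡.refl) (yes _)   = refl
    go (yes ≡.refl) (no a≰0)  = ⊥-elim (a≰0 z≤n)
    go (no a≢0)     (yes a≤0) = ⊥-elim (a≢0 (ℕₚ.n≤0⇒n≡0 a≤0))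
    go (no _)       (no _)    = refl
  Σ≤-select (suc m) a h =
    trans (+-congʳ (Σ≤-select m a h)) (go (a ℕ.≤? m) (a ℕ.≟ suc m) (a ℕ.≤? suc m))
    where
    go : (a≤?m : Dec (a ≤ m)) (a≟1+m : Dec (a ≡ suc m)) (a≤?1+m : Dec (a ≤ suc m)) →
         [ does a≤?m ]· h a + [ does a≟1+m ]· h (suc m) ≈ [ does a≤?1+m ]· h a
    go (yes a≤m) (yes ≡.refl) _           = ⊥-elim (ℕₚ.n≮n _ a≤m)
    go (yes _)   (no _)       (yes _)     = +-identityʳ _
    go (yes a≤m) (no _)       (no a≰1+m)  = ⊥-elim (a≰1+m (ℕₚ.m≤n⇒m≤1+n a≤m))
    go (no _)    (yes ≡.refl) (yes _)     = +-identityˡ _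
    go (no _)    (yes ≡.refl) (no a≰a)    = ⊥-elim (a≰a ℕₚ.≤-refl)
    go (no a≰m)  (no a≢1+m)   (yes a≤1+m) = ⊥-elim (a≰m (ℕ.s≤s⁻¹ (ℕₚ.≤∧≢⇒< a≤1+m a≢1+m)))
    go (no _)    (no _)       (no _)      = +-identityˡ _

  Σ≤-swap : ∀ n m (F : ℕ → ℕ → Carrier) → Σ≤ n (λ i → Σ≤ m (F i)) ≈ Σ≤ m (λ j → Σ≤ n (λ i → F i j))
  Σ≤-swap zero    m F = refl
  Σ≤-swap (suc n) m F = trans (+-congʳ (Σ≤-swap n m F)) (sym (Σ≤-+ m (λ j → Σ≤ n (λ i → F i j)) (F (suc n))))

  Σ≤-reverse : ∀ n (f : ℕ → Carrier) → Σ≤ n f ≈ Σ≤ n (λ i → f (n ∸ i))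
  Σ≤-reverse zero    f = refl
  Σ≤-reverse (suc n) f = begin
    Σ≤ n f + f (suc n)                   ≈⟨ +-congʳ (Σ≤-reverse n f) ⟩
    Σ≤ n (λ i → f (n ∸ i)) + f (suc n)   ≈⟨ +-comm _ _ ⟩
    f (suc n) + Σ≤ n (λ i → f (n ∸ i))   ≈⟨ Σ≤-suc n (λ i → f (suc n ∸ i)) ⟨
    Σ≤ (suc n) (λ i → f (suc n ∸ i))     ∎

  -- Both sides sum G i t over the triangle i + t ≤ n.
  Σ≤-triangle : ∀ n (G : ℕ → ℕ → Carrier) →
                Σ≤ n (λ j → Σ≤ j (λ i → G i (j ∸ i))) ≈ Σ≤ n (λ i → Σ≤ (n ∸ i) (G i))
  Σ≤-triangle zero    G = refl
  Σ≤-triangle (suc n) G = begin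
    Σ≤ n (λ j → Σ≤ j (λ i → G i (j ∸ i))) + Σ≤ (suc n) (λ i → G i (suc n ∸ i))
      ≈⟨ +-cong (Σ≤-triangle n G) (+-congˡ (reflexive (≡.cong (G (suc n)) (ℕₚ.n∸n≡0 n)))) ⟩
    Σ≤ n (λ i → Σ≤ (n ∸ i) (G i)) + (Σ≤ n (λ i → G i (suc n ∸ i)) + G (suc n) 0)
      ≈⟨ +-assoc _ _ _ ⟨
    (Σ≤ n (λ i → Σ≤ (n ∸ i) (G i)) + Σ≤ n (λ i → G i (suc n ∸ i))) + G (suc n) 0
      ≈⟨ +-congʳ (Σ≤-+ n _ _) ⟨
    Σ≤ n (λ i → Σ≤ (n ∸ i) (G i) + G i (suc n ∸ i)) + G (suc n) 0
      ≈⟨ +-congʳ (Σ≤-cong n λ i i≤n → reflexive (≡.cong (λ z → Σ≤ (n ∸ i) (G i) + G i z) (ℕₚ.+-∸-assoc 1 i≤n))) ⟩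
    Σ≤ n (λ i → Σ≤ (suc (n ∸ i)) (G i)) + G (suc n) 0
      ≈⟨ +-congʳ (Σ≤-cong n λ i i≤n → reflexive (≡.cong (λ z → Σ≤ z (G i)) (≡.sym (ℕₚ.+-∸-assoc 1 i≤n)))) ⟩
    Σ≤ n (λ i → Σ≤ (suc n ∸ i) (G i)) + G (suc n) 0
      ≈⟨ +-congˡ (reflexive (≡.cong (λ z → Σ≤ z (G (suc n))) (≡.sym (ℕₚ.n∸n≡0 n)))) ⟩
    Σ≤ n (λ i → Σ≤ (suc n ∸ i) (G i)) + Σ≤ (suc n ∸ suc n) (G (suc n)) ∎

  Σ∈-cong : ∀ {a} {A : Set a} (xs : List A) {f g : A → Carrier} → (∀ x → f x ≈ g x) → Σ∈ xs f ≈ Σ∈ xs g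
  Σ∈-cong []       f≈g = refl
  Σ∈-cong (x ∷ xs) f≈g = +-cong (f≈g x) (Σ∈-cong xs f≈g)

  Σ∈-+ : ∀ {a} {A : Set a} (xs : List A) (f g : A → Carrier) → Σ∈ xs (λ x → f x + g x) ≈ Σ∈ xs f + Σ∈ xs g
  Σ∈-+ []       f g = sym (+-identityˡ 0#)
  Σ∈-+ (x ∷ xs) f g = trans (+-congˡ (Σ∈-+ xs f g)) (+-interchange _ _ _ _)

  *-distribˡ-Σ∈ : ∀ {a} {A : Set a} (xs : List A) y (f : A → Carrier) → y * Σ∈ xs f ≈ Σ∈ xs (λ x → y * f x)
  *-distribˡ-Σ∈ []       y f = zeroʳ y
  *-distribˡ-Σ∈ (x ∷ xs) y f = trans (distribˡ _ _ _) (+-congˡ (*-distribˡ-Σ∈ xs y f))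

  *-distribʳ-Σ∈ : ∀ {a} {A : Set a} (xs : List A) y (f : A → Carrier) → Σ∈ xs f * y ≈ Σ∈ xs (λ x → f x * y)
  *-distribʳ-Σ∈ []       y f = zeroˡ y
  *-distribʳ-Σ∈ (x ∷ xs) y f = trans (distribʳ _ _ _) (+-congˡ (*-distribʳ-Σ∈ xs y f))

  Σ∈-zero : ∀ {a} {A : Set a} (xs : List A) {f : A → Carrier} → (∀ x → f x ≈ 0#) → Σ∈ xs f ≈ 0#
  Σ∈-zero []       f≈0 = refl
  Σ∈-zero (x ∷ xs) f≈0 = trans (+-cong (f≈0 x) (Σ∈-zero xs f≈0)) (+-identityˡ 0#)

  []·-Σ∈ : ∀ {a} {A : Set a} b (xs : List A) f → [ b ]· Σ∈ xs f ≈ Σ∈ xs (λ x → [ b ]· f x)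
  []·-Σ∈ true  xs f = refl
  []·-Σ∈ false xs f = sym (Σ∈-zero xs λ _ → refl)

  Σ∈-++ : ∀ {a} {A : Set a} (xs ys : List A) (f : A → Carrier) → Σ∈ (xs List.++ ys) f ≈ Σ∈ xs f + Σ∈ ys f
  Σ∈-++ []       ys f = sym (+-identityˡ _)
  Σ∈-++ (x ∷ xs) ys f = trans (+-congˡ (Σ∈-++ xs ys f)) (sym (+-assoc _ _ _))

  Σ∈-map : ∀ {a b} {A : Set a} {B : Set b} (h : A → B) (xs : List A) (f : B → Carrier) →
           Σ∈ (List.map h xs) f ≈ Σ∈ xs (λ x → f (h x))
  Σ∈-map h []       f = refl
  Σ∈-map h (x ∷ xs) f = +-congˡ (Σ∈-map h xs f)

  Σ∈-concatMap : ∀ {a b} {A : Set a} {B : Set b} (h : A → List B) (xs : List A) (f : B → Carrier) →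
                 Σ∈ (List.concatMap h xs) f ≈ Σ∈ xs (λ x → Σ∈ (h x) f)
  Σ∈-concatMap h []       f = refl
  Σ∈-concatMap h (x ∷ xs) f = trans (Σ∈-++ (h x) (List.concatMap h xs) f) (+-congˡ (Σ∈-concatMap h xs f))

  Σ∈-upTo : ∀ n (f : ℕ → Carrier) → Σ∈ (List.upTo (suc n)) f ≈ Σ≤ n f
  Σ∈-upTo n f = applyUpTo n (λ i → i)
    where
    applyUpTo : ∀ n (h : ℕ → ℕ) → Σ∈ (List.applyUpTo h (suc n)) f ≈ Σ≤ n (λ i → f (h i))
    applyUpTo zero    h = +-identityʳ _
    applyUpTo (suc n) h = trans (+-congˡ (applyUpTo n (λ i → h (suc i)))) (sym (Σ≤-suc n (λ i → f (h i))))

  Σ≤-Σ∈ : ∀ {a} {A : Set a} (xs : List A) n (F : ℕ → A → Carrier) →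
          Σ≤ n (λ t → Σ∈ xs (F t)) ≈ Σ∈ xs (λ x → Σ≤ n (λ t → F t x))
  Σ≤-Σ∈ xs zero    F = refl
  Σ≤-Σ∈ xs (suc n) F = trans (+-congʳ (Σ≤-Σ∈ xs n F)) (sym (Σ∈-+ xs _ _))

  Σ∈-swap : ∀ {a b} {A : Set a} {B : Set b} (xs : List A) (ys : List B) (F : A → B → Carrier) →
            Σ∈ xs (λ x → Σ∈ ys (F x)) ≈ Σ∈ ys (λ y → Σ∈ xs (λ x → F x y))
  Σ∈-swap []       ys F = sym (Σ∈-zero ys λ _ → refl)
  Σ∈-swap (x ∷ xs) ys F = trans (+-congˡ (Σ∈-swap xs ys F)) (sym (Σ∈-+ ys _ _))

  Σ∈-filter : ∀ {a p} {A : Set a} {P : A → Set p} (P? : ∀ x → Dec (P x)) (xs : List A) (f : A → Carrier) →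
              Σ∈ (List.filter P? xs) f ≈ Σ∈ xs (λ x → [ does (P? x) ]· f x)
  Σ∈-filter P? []       f = refl
  Σ∈-filter P? (x ∷ xs) f with does (P? x)
  ... | true  = +-congˡ (Σ∈-filter P? xs f)
  ... | false = trans (Σ∈-filter P? xs f) (sym (+-identityˡ _))

  fromℕ-+ : ∀ a b → fromℕ R (a ℕ.+ b) ≈ fromℕ R a + fromℕ R b
  fromℕ-+ zero    b = sym (+-identityˡ _)
  fromℕ-+ (suc a) b = trans (+-congˡ (fromℕ-+ a b)) (sym (+-assoc _ _ _))

  fromℕ-* : ∀ a b → fromℕ R (a ℕ.* b) ≈ fromℕ R a * fromℕ R b
  fromℕ-* zero    b = sym (zeroˡ _)
  fromℕ-* (suc a) b = trans (fromℕ-+ b (a ℕ.* b))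
                            (trans (+-cong (sym (*-identityˡ _)) (fromℕ-* a b)) (sym (distribʳ _ _ _)))

  _^_ : Carrier → ℕ → Carrier
  _^_ = _^^_ R

  infixr 8 _^_

  ^-cong : ∀ {x y} n → x ≈ y → x ^ n ≈ y ^ n
  ^-cong zero    x≈y = refl
  ^-cong (suc n) x≈y = *-cong x≈y (^-cong n x≈y)

  ^-+ : ∀ x a b → x ^ (a ℕ.+ b) ≈ x ^ a * x ^ b
  ^-+ x zero    b = sym (*-identityˡ _)
  ^-+ x (suc a) b = trans (*-congˡ (^-+ x a b)) (sym (*-assoc _ _ _))

  1^n≈1 : ∀ n → 1# ^ n ≈ 1#
  1^n≈1 zero    = refl
  1^n≈1 (suc n) = trans (*-identityˡ _) (1^n≈1 n)

module PowerSeries {c ℓ} (R : CommutativeRing c ℓ) where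
  open CommutativeRing R hiding (zero)
  open FiniteSums R
  open import Relation.Binary.Reasoning.Setoid setoid
  open import Algebra.Properties.CommutativeSemigroup *-commutativeSemigroup
    using () renaming (interchange to *-interchange)

  S : Set c
  S = Series R

  infix  4 _≋_
  infixl 6 _+ₛ_
  infixl 7 _*ₛ_
  infixr 8 _^ₛ_

  _≋_ : S → S → Set ℓ
  a ≋ b = ∀ n → a n ≈ b n

  _+ₛ_ : S → S → S
  (a +ₛ b) n = a n + b n

  0ₛ : S
  0ₛ _ = 0#

  1ₛ : S
  1ₛ = oneS R

  _*ₛ_ : S → S → S
  _*ₛ_ = mulS R

  _^ₛ_ : S → ℕ → S
  _^ₛ_ = powS R

  _∘ₛ_ : S → S → S
  _∘ₛ_ = compS R

  *ₛ-cong : ∀ {a a′ b b′} → a ≋ a′ → b ≋ b′ → a *ₛ b ≋ a′ *ₛ b′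
  *ₛ-cong a≋a′ b≋b′ n = Σ≤-cong n λ i _ → *-cong (a≋a′ i) (b≋b′ (n ∸ i))

  *ₛ-congˡ : ∀ a {b b′} → b ≋ b′ → a *ₛ b ≋ a *ₛ b′
  *ₛ-congˡ a = *ₛ-cong {a} (λ _ → refl)

  *ₛ-congʳ : ∀ {a a′} b → a ≋ a′ → a *ₛ b ≋ a′ *ₛ b
  *ₛ-congʳ b a≋a′ = *ₛ-cong {b = b} a≋a′ (λ _ → refl)

  *ₛ-comm : ∀ a b → a *ₛ b ≋ b *ₛ a
  *ₛ-comm a b n = begin
    Σ≤ n (λ i → a i * b (n ∸ i))             ≈⟨ Σ≤-reverse n _ ⟩
    Σ≤ n (λ i → a (n ∸ i) * b (n ∸ (n ∸ i))) ≈⟨ Σ≤-cong n (λ i i≤n →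
                                                 trans (*-comm _ _) (*-congʳ (reflexive (≡.cong b (ℕₚ.m∸[m∸n]≡n i≤n))))) ⟩
    Σ≤ n (λ i → b i * a (n ∸ i))             ∎

  *ₛ-assoc : ∀ a b d → (a *ₛ b) *ₛ d ≋ a *ₛ (b *ₛ d)
  *ₛ-assoc a b d n = begin
    Σ≤ n (λ j → Σ≤ j (λ i → a i * b (j ∸ i)) * d (n ∸ j))
      ≈⟨ Σ≤-cong n (λ j _ → *-distribʳ-Σ≤ j _ _) ⟩
    Σ≤ n (λ j → Σ≤ j (λ i → (a i * b (j ∸ i)) * d (n ∸ j)))
      ≈⟨ Σ≤-cong n (λ j _ → Σ≤-cong j λ i i≤j →
           trans (*-assoc _ _ _) (*-congˡ (*-congˡ (reflexive (≡.cong d (n∸j≡[n∸i]∸[j∸i] i≤j)))))) ⟩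
    Σ≤ n (λ j → Σ≤ j (λ i → a i * (b (j ∸ i) * d ((n ∸ i) ∸ (j ∸ i)))))
      ≈⟨ Σ≤-triangle n (λ i t → a i * (b t * d ((n ∸ i) ∸ t))) ⟩
    Σ≤ n (λ i → Σ≤ (n ∸ i) (λ t → a i * (b t * d ((n ∸ i) ∸ t))))
      ≈⟨ Σ≤-cong n (λ i _ → *-distribˡ-Σ≤ (n ∸ i) _ _) ⟨
    Σ≤ n (λ i → a i * (b *ₛ d) (n ∸ i)) ∎
    where
    n∸j≡[n∸i]∸[j∸i] : ∀ {i j} → i ≤ j → n ∸ j ≡ (n ∸ i) ∸ (j ∸ i)
    n∸j≡[n∸i]∸[j∸i] {i} {j} i≤j =
      ≡.trans (≡.cong (n ∸_) (≡.sym (ℕₚ.m+[n∸m]≡n i≤j))) (≡.sym (ℕₚ.∸-+-assoc n i (j ∸ i)))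

  *ₛ-distribˡ : ∀ a b d → a *ₛ (b +ₛ d) ≋ a *ₛ b +ₛ a *ₛ d
  *ₛ-distribˡ a b d n = trans (Σ≤-cong n λ _ _ → distribˡ _ _ _) (Σ≤-+ n _ _)

  *ₛ-distribʳ : ∀ a b d → (b +ₛ d) *ₛ a ≋ b *ₛ a +ₛ d *ₛ a
  *ₛ-distribʳ a b d n = trans (Σ≤-cong n λ _ _ → distribʳ _ _ _) (Σ≤-+ n _ _)

  *ₛ-identityˡ : ∀ a → 1ₛ *ₛ a ≋ a
  *ₛ-identityˡ a zero    = *-identityˡ _
  *ₛ-identityˡ a (suc n) = begin
    Σ≤ (suc n) (λ i → 1ₛ i * a (suc n ∸ i))          ≈⟨ Σ≤-suc n _ ⟩
    1# * a (suc n) + Σ≤ n (λ i → 0# * a (n ∸ i))    ≈⟨ +-cong (*-identityˡ _) (Σ≤-zero n λ _ _ → zeroˡ _) ⟩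
    a (suc n) + 0#                                  ≈⟨ +-identityʳ _ ⟩
    a (suc n)                                       ∎

  *ₛ-identityʳ : ∀ a → a *ₛ 1ₛ ≋ a
  *ₛ-identityʳ a n = trans (*ₛ-comm a 1ₛ n) (*ₛ-identityˡ a n)

  +ₛ-*ₛ-isCommutativeSemiring : IsCommutativeSemiring _≋_ _+ₛ_ _*ₛ_ 0ₛ 1ₛ
  +ₛ-*ₛ-isCommutativeSemiring = record
    { isSemiring = record
      { isSemiringWithoutAnnihilatingZero = record
        { +-isCommutativeMonoid = record
          { isMonoid = record
            { isSemigroup = record
              { isMagma = record
                { isEquivalence = record
                  { refl = λ _ → refl ; sym = λ e n → sym (e n) ; trans = λ e e′ n → trans (e n) (e′ n) }
                ; ∙-cong = λ e e′ n → +-cong (e n) (e′ n) }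
              ; assoc = λ _ _ _ _ → +-assoc _ _ _ }
            ; identity = (λ _ _ → +-identityˡ _) , (λ _ _ → +-identityʳ _) }
          ; comm = λ _ _ _ → +-comm _ _ }
        ; *-cong = *ₛ-cong
        ; *-assoc = *ₛ-assoc
        ; *-identity = *ₛ-identityˡ , *ₛ-identityʳ
        ; distrib = *ₛ-distribˡ , *ₛ-distribʳ }
      ; zero = (λ _ n → Σ≤-zero n λ _ _ → zeroˡ _) , (λ _ n → Σ≤-zero n λ _ _ → zeroʳ _) }
    ; *-comm = *ₛ-comm }

  +ₛ-*ₛ-commutativeSemiring : CommutativeSemiring c ℓ
  +ₛ-*ₛ-commutativeSemiring = record { isCommutativeSemiring = +ₛ-*ₛ-isCommutativeSemiring }

  module _ {g : S} (g₀≈0 : g 0 ≈ 0#) where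

    ^ₛ-vanishes-below : ∀ j n → n < j → (g ^ₛ j) n ≈ 0#
    ^ₛ-vanishes-below (suc j) n (s≤s n≤j) = Σ≤-zero n term≈0
      where
      term≈0 : ∀ i → i ≤ n → g i * (g ^ₛ j) (n ∸ i) ≈ 0#
      term≈0 zero    _      = trans (*-congʳ g₀≈0) (zeroˡ _)
      term≈0 (suc i) 1+i≤n = trans (*-congˡ (^ₛ-vanishes-below j (n ∸ suc i)
        (ℕₚ.<-≤-trans (ℕₚ.∸-monoʳ-< {n} {suc i} {0} (s≤s z≤n) 1+i≤n) n≤j))) (zeroʳ _)

    ∘ₛ-extend : ∀ a n N → n ≤ N → Σ≤ N (λ j → a j * (g ^ₛ j) n) ≈ (a ∘ₛ g) n
    ∘ₛ-extend a n N n≤N =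
      Σ≤-extend n N _ n≤N λ j n<j → trans (*-congˡ (^ₛ-vanishes-below j n n<j)) (zeroʳ _)

  ^ₛ-+ : ∀ g i j → g ^ₛ (i ℕ.+ j) ≋ g ^ₛ i *ₛ g ^ₛ j
  ^ₛ-+ g zero    j n = sym (*ₛ-identityˡ (g ^ₛ j) n)
  ^ₛ-+ g (suc i) j n = trans (*ₛ-congˡ g (^ₛ-+ g i j) n) (sym (*ₛ-assoc g (g ^ₛ i) (g ^ₛ j) n))

  ^ₛ-cong : ∀ {a b} k → a ≋ b → a ^ₛ k ≋ b ^ₛ k
  ^ₛ-cong zero    a≋b _ = refl
  ^ₛ-cong (suc k) a≋b   = *ₛ-cong a≋b (^ₛ-cong k a≋b)

  module _ {g : S} (g₀≈0 : g 0 ≈ 0#) where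

    ∘ₛ-*ₛ : ∀ a b → (a *ₛ b) ∘ₛ g ≋ (a ∘ₛ g) *ₛ (b ∘ₛ g)
    ∘ₛ-*ₛ a b n = trans lhs≈ (sym rhs≈)
      where
      X : ℕ → ℕ → Carrier
      X i j = (a i * b j) * (g ^ₛ (i ℕ.+ j)) n

      lhs≈ : ((a *ₛ b) ∘ₛ g) n ≈ Σ≤ n (λ i → Σ≤ (n ∸ i) (X i))
      lhs≈ = begin
        Σ≤ n (λ s → Σ≤ s (λ i → a i * b (s ∸ i)) * (g ^ₛ s) n)
          ≈⟨ Σ≤-cong n (λ s _ → *-distribʳ-Σ≤ s _ _) ⟩
        Σ≤ n (λ s → Σ≤ s (λ i → (a i * b (s ∸ i)) * (g ^ₛ s) n))
          ≈⟨ Σ≤-cong n (λ s _ → Σ≤-cong s λ i i≤s →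
               *-congˡ (reflexive (≡.cong (λ z → (g ^ₛ z) n) (≡.sym (ℕₚ.m+[n∸m]≡n i≤s))))) ⟩
        Σ≤ n (λ s → Σ≤ s (λ i → X i (s ∸ i)))
          ≈⟨ Σ≤-triangle n X ⟩
        Σ≤ n (λ i → Σ≤ (n ∸ i) (X i)) ∎

      n<i+j : ∀ i j → n ∸ i < j → n < i ℕ.+ j
      n<i+j i j n∸i<j = ℕₚ.≤-<-trans (ℕₚ.m≤n+m∸n n i) (ℕₚ.+-monoʳ-< i n∸i<j)

      rhs≈ : ((a ∘ₛ g) *ₛ (b ∘ₛ g)) n ≈ Σ≤ n (λ i → Σ≤ (n ∸ i) (X i))
      rhs≈ = begin
        Σ≤ n (λ t → (a ∘ₛ g) t * (b ∘ₛ g) (n ∸ t))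
          ≈⟨ Σ≤-cong n (λ t t≤n → *-cong (∘ₛ-extend g₀≈0 a t n t≤n) (∘ₛ-extend g₀≈0 b (n ∸ t) n (ℕₚ.m∸n≤m n t))) ⟨
        Σ≤ n (λ t → Σ≤ n (λ i → a i * (g ^ₛ i) t) * Σ≤ n (λ j → b j * (g ^ₛ j) (n ∸ t)))
          ≈⟨ Σ≤-cong n (λ t _ → trans (*-distribʳ-Σ≤ n _ _) (Σ≤-cong n λ i _ →
               trans (*-distribˡ-Σ≤ n _ _) (Σ≤-cong n λ j _ → *-interchange _ _ _ _))) ⟩
        Σ≤ n (λ t → Σ≤ n (λ i → Σ≤ n (λ j → (a i * b j) * ((g ^ₛ i) t * (g ^ₛ j) (n ∸ t)))))
          ≈⟨ Σ≤-swap n n _ ⟩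
        Σ≤ n (λ i → Σ≤ n (λ t → Σ≤ n (λ j → (a i * b j) * ((g ^ₛ i) t * (g ^ₛ j) (n ∸ t)))))
          ≈⟨ Σ≤-cong n (λ i _ → Σ≤-swap n n _) ⟩
        Σ≤ n (λ i → Σ≤ n (λ j → Σ≤ n (λ t → (a i * b j) * ((g ^ₛ i) t * (g ^ₛ j) (n ∸ t)))))
          ≈⟨ Σ≤-cong n (λ i _ → Σ≤-cong n λ j _ → trans (sym (*-distribˡ-Σ≤ n _ _)) (*-congˡ (sym (^ₛ-+ g i j n)))) ⟩
        Σ≤ n (λ i → Σ≤ n (X i))
          ≈⟨ Σ≤-cong n (λ i _ → Σ≤-extend (n ∸ i) n (X i) (ℕₚ.m∸n≤m n i) λ j n∸i<j →
               trans (*-congˡ (^ₛ-vanishes-below g₀≈0 (i ℕ.+ j) n (n<i+j i j n∸i<j))) (zeroʳ _)) ⟩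
        Σ≤ n (λ i → Σ≤ (n ∸ i) (X i)) ∎

    1ₛ-∘ₛ : 1ₛ ∘ₛ g ≋ 1ₛ
    1ₛ-∘ₛ zero    = *-identityˡ _
    1ₛ-∘ₛ (suc n) = trans (Σ≤-suc n _) (trans (+-cong (*-identityˡ _) (Σ≤-zero n λ _ _ → zeroˡ _)) (+-identityˡ _))

    ^ₛ-∘ₛ : ∀ f k → (f ∘ₛ g) ^ₛ k ≋ (f ^ₛ k) ∘ₛ g
    ^ₛ-∘ₛ f zero    n = sym (1ₛ-∘ₛ n)
    ^ₛ-∘ₛ f (suc k) n = trans (*ₛ-congˡ (f ∘ₛ g) (^ₛ-∘ₛ f k) n) (sym (∘ₛ-*ₛ f (f ^ₛ k) n))

  module _ where
    open import Data.Fin using (toℕ)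
    open import Algebra.Properties.CommutativeSemiring.Binomial +ₛ-*ₛ-commutativeSemiring
      using (binomialExpansion) renaming (theorem to binomialTheorem)
    open import Algebra.Definitions.RawMonoid (CommutativeSemiring.+-rawMonoid +ₛ-*ₛ-commutativeSemiring)
      using () renaming (sum to ∑; _×_ to _×′_)
    open import Algebra.Properties.Semiring.Exp (CommutativeSemiring.semiring +ₛ-*ₛ-commutativeSemiring)
      using () renaming (_^_ to _^′_)

    private
      sum-coeff : ∀ n (F : ℕ → S) N → ∑ {suc n} (λ i → F (toℕ i)) N ≈ Σ≤ n (λ i → F i N)
      sum-coeff zero    F N = +-identityʳ _
      sum-coeff (suc n) F N = trans (+-congˡ (sum-coeff n (λ i → F (suc i)) N)) (sym (Σ≤-suc n (λ i → F i N)))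

      ×-coeff : ∀ m (a : S) N → (m ×′ a) N ≈ fromℕ R m * a N
      ×-coeff zero    a N = sym (zeroˡ _)
      ×-coeff (suc m) a N = trans (+-cong (sym (*-identityˡ _)) (×-coeff m a N)) (sym (distribʳ _ _ _))

      ^ₛ≡^′ : ∀ a k → a ^ₛ k ≡ a ^′ k
      ^ₛ≡^′ a zero    = ≡.refl
      ^ₛ≡^′ a (suc k) = ≡.cong (a *ₛ_) (^ₛ≡^′ a k)

    binomial-coeff : ∀ a b k N →
                     ((a +ₛ b) ^ₛ k) N ≈ Σ≤ k (λ i → fromℕ R (k C i) * (a ^ₛ i *ₛ b ^ₛ (k ∸ i)) N)
    binomial-coeff a b k N = begin
      ((a +ₛ b) ^ₛ k) N                                    ≡⟨ ≡.cong (λ z → z N) (^ₛ≡^′ (a +ₛ b) k) ⟩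
      ((a +ₛ b) ^′ k) N                                    ≈⟨ binomialTheorem k a b N ⟩
      binomialExpansion a b k N                            ≈⟨ sum-coeff k (λ i → (k C i) ×′ (a ^′ i *ₛ b ^′ (k ∸ i))) N ⟩
      Σ≤ k (λ i → ((k C i) ×′ (a ^′ i *ₛ b ^′ (k ∸ i))) N)  ≈⟨ Σ≤-cong k (λ i _ → ×-coeff (k C i) _ N) ⟩
      Σ≤ k (λ i → fromℕ R (k C i) * (a ^′ i *ₛ b ^′ (k ∸ i)) N)
        ≈⟨ Σ≤-cong k (λ i _ → reflexive (≡.cong₂ (λ u v → fromℕ R (k C i) * (u *ₛ v) N)
                                             (≡.sym (^ₛ≡^′ a i)) (≡.sym (^ₛ≡^′ b (k ∸ i))))) ⟩
      Σ≤ k (λ i → fromℕ R (k C i) * (a ^ₛ i *ₛ b ^ₛ (k ∸ i)) N) ∎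

  monomial : Carrier → ℕ → S
  monomial α d n = [ d ≡ᵇ n ]· α

  monomial-*ₛ : ∀ α d a n → (monomial α d *ₛ a) n ≈ [ d ≤ᵇ n ]· (α * a (n ∸ d))
  monomial-*ₛ α d a n =
    trans (Σ≤-cong n λ i _ → []·-*ʳ (d ≡ᵇ i) α _) (Σ≤-select n d (λ i → α * a (n ∸ i)))

  monomial-^ₛ : ∀ α d y → monomial α d ^ₛ y ≋ monomial (α ^ y) (y ℕ.* d)
  monomial-^ₛ α d zero    zero    = refl
  monomial-^ₛ α d zero    (suc n) = refl
  monomial-^ₛ α d (suc y) n = begin
    (monomial α d *ₛ monomial α d ^ₛ y) n              ≈⟨ *ₛ-congˡ (monomial α d) (monomial-^ₛ α d y) n ⟩
    (monomial α d *ₛ monomial (α ^ y) (y ℕ.* d)) n     ≈⟨ monomial-*ₛ α d (monomial (α ^ y) (y ℕ.* d)) n ⟩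
    [ d ≤ᵇ n ]· (α * [ y ℕ.* d ≡ᵇ n ∸ d ]· α ^ y)      ≈⟨ []·-cong (d ≤ᵇ n) ([]·-*ˡ (y ℕ.* d ≡ᵇ n ∸ d) α (α ^ y)) ⟩
    [ d ≤ᵇ n ]· [ y ℕ.* d ≡ᵇ n ∸ d ]· (α * α ^ y)      ≈⟨ []·-≤-≡∸ d (y ℕ.* d) n _ ⟩
    [ d ℕ.+ y ℕ.* d ≡ᵇ n ]· (α * α ^ y)                ∎

module BoxSums {c ℓ} (R : CommutativeRing c ℓ) where
  open CommutativeRing R hiding (zero)
  open FiniteSums R
  open TupleStatistics
  open import Relation.Binary.Reasoning.Setoid setoid

  Σ∈-box-suc : ∀ D B (h : Vec ℕ (suc D) → Carrier) →
               Σ∈ (box (suc D) B) h ≈ Σ≤ B (λ y → Σ∈ (box D B) (λ v → h (y ∷ v)))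
  Σ∈-box-suc D B h = begin
    Σ∈ (box (suc D) B) h                                       ≈⟨ Σ∈-concatMap (λ y → List.map (y ∷_) (box D B)) 0…B h ⟩
    Σ∈ 0…B (λ y → Σ∈ (List.map (y ∷_) (box D B)) h)            ≈⟨ Σ∈-cong 0…B (λ y → Σ∈-map (y ∷_) (box D B) h) ⟩
    Σ∈ 0…B (λ y → Σ∈ (box D B) (λ v → h (y ∷ v)))              ≈⟨ Σ∈-upTo B _ ⟩
    Σ≤ B (λ y → Σ∈ (box D B) (λ v → h (y ∷ v)))                ∎
    where 0…B = List.upTo (suc B)

  Σ∈-tuplesOf-suc : ∀ {a} {A : Set a} s (xs : List A) (h : List A → Carrier) →
                    Σ∈ (tuplesOf (suc s) xs) h ≈ Σ∈ xs (λ x → Σ∈ (tuplesOf s xs) (λ ts → h (x ∷ ts)))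
  Σ∈-tuplesOf-suc s xs h =
    trans (Σ∈-concatMap (λ x → List.map (x ∷_) (tuplesOf s xs)) xs h)
          (Σ∈-cong xs λ x → Σ∈-map (x ∷_) (tuplesOf s xs) h)

  Σ∈-box-shrink : ∀ D {B B′} → B ≤ B′ → (h : Vec ℕ D → Carrier) → (∀ v → bounded B v ≡ false → h v ≈ 0#) →
                  Σ∈ (box D B′) h ≈ Σ∈ (box D B) h
  Σ∈-box-shrink zero    B≤B′ h h≈0 = refl
  Σ∈-box-shrink (suc D) {B} {B′} B≤B′ h h≈0 = begin
    Σ∈ (box (suc D) B′) h                        ≈⟨ Σ∈-box-suc D B′ h ⟩
    Σ≤ B′ (λ y → Σ∈ (box D B′) (λ v → h (y ∷ v))) ≈⟨ Σ≤-cong B′ (λ y _ → shrink y) ⟩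
    Σ≤ B′ K                                      ≈⟨ Σ≤-extend B B′ K B≤B′ (λ y B<y → Σ∈-zero (box D B) (out-of-box B<y)) ⟩
    Σ≤ B K                                       ≈⟨ Σ∈-box-suc D B h ⟨
    Σ∈ (box (suc D) B) h                         ∎
    where
    K : ℕ → Carrier
    K y = Σ∈ (box D B) (λ v → h (y ∷ v))
    out-of-box : ∀ {y} → B < y → ∀ v → h (y ∷ v) ≈ 0#
    out-of-box B<y v = h≈0 (_ ∷ v) (≡.cong (_∧ bounded B v) (>⇒≤ᵇ≡false B<y))
    shrink : ∀ y → Σ∈ (box D B′) (λ v → h (y ∷ v)) ≈ K y
    shrink y with y ℕ.≤? B
    ... | yes y≤B = Σ∈-box-shrink D B≤B′ (λ v → h (y ∷ v))
                      (λ v e → h≈0 (y ∷ v) (≡.cong₂ _∧_ (≤⇒≤ᵇ≡true y≤B) e))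
    ... | no  y≰B = trans (Σ∈-zero (box D B′) (out-of-box (ℕₚ.≰⇒> y≰B)))
                          (sym (Σ∈-zero (box D B) (out-of-box (ℕₚ.≰⇒> y≰B))))

  Σ∈-tuplesOf-shrink : ∀ s D {B B′} → B ≤ B′ → (h : List (Vec ℕ D) → Carrier) →
                       (∀ ts → allBounded B ts ≡ false → h ts ≈ 0#) →
                       Σ∈ (tuplesOf s (box D B′)) h ≈ Σ∈ (tuplesOf s (box D B)) h
  Σ∈-tuplesOf-shrink zero    D B≤B′ h h≈0 = refl
  Σ∈-tuplesOf-shrink (suc s) D {B} {B′} B≤B′ h h≈0 = begin
    Σ∈ (tuplesOf (suc s) (box D B′)) h                          ≈⟨ Σ∈-tuplesOf-suc s (box D B′) h ⟩
    Σ∈ (box D B′) (λ x → Σ∈ (tuplesOf s (box D B′)) (λ ts → h (x ∷ ts)))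
      ≈⟨ Σ∈-cong (box D B′) (λ x → Σ∈-tuplesOf-shrink s D B≤B′ (λ ts → h (x ∷ ts))
           λ ts e → h≈0 (x ∷ ts) (≡.trans (≡.cong (bounded B x ∧_) e) (∧-zeroʳ _))) ⟩
    Σ∈ (box D B′) K
      ≈⟨ Σ∈-box-shrink D B≤B′ K (λ x e → Σ∈-zero (tuplesOf s (box D B))
           λ ts → h≈0 (x ∷ ts) (≡.cong (_∧ allBounded B ts) e)) ⟩
    Σ∈ (box D B) K                                              ≈⟨ Σ∈-tuplesOf-suc s (box D B) h ⟨
    Σ∈ (tuplesOf (suc s) (box D B)) h                           ∎
    where
    K : Vec ℕ D → Carrier
    K x = Σ∈ (tuplesOf s (box D B)) (λ ts → h (x ∷ ts))

  Σ∈-tuplesOf-cong : ∀ {a} {A : Set a} s (xs : List A) {h h′ : List A → Carrier} →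
                     (∀ ts → List.length ts ≡ s → h ts ≈ h′ ts) → Σ∈ (tuplesOf s xs) h ≈ Σ∈ (tuplesOf s xs) h′
  Σ∈-tuplesOf-cong zero    xs h≈h′ = +-congʳ (h≈h′ [] ≡.refl)
  Σ∈-tuplesOf-cong (suc s) xs {h} {h′} h≈h′ = begin
    Σ∈ (tuplesOf (suc s) xs) h                                ≈⟨ Σ∈-tuplesOf-suc s xs h ⟩
    Σ∈ xs (λ x → Σ∈ (tuplesOf s xs) (λ ts → h (x ∷ ts)))      ≈⟨ Σ∈-cong xs (λ x → Σ∈-tuplesOf-cong s xs
                                                                   λ ts len → h≈h′ (x ∷ ts) (≡.cong suc len)) ⟩
    Σ∈ xs (λ x → Σ∈ (tuplesOf s xs) (λ ts → h′ (x ∷ ts)))     ≈⟨ Σ∈-tuplesOf-suc s xs h′ ⟨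
    Σ∈ (tuplesOf (suc s) xs) h′                               ∎

  infix 4 _≟ᵛ_

  _≟ᵛ_ : ∀ {D} (u v : Vec ℕ D) → Dec (u ≡ v)
  _≟ᵛ_ = ≡-dec ℕ._≟_

  Σ∈-box-select : ∀ D B (v : Vec ℕ D) x → Σ∈ (box D B) (λ u → [ does (v ≟ᵛ u) ]· x) ≈ [ bounded B v ]· x
  Σ∈-box-select zero    B []      x = +-identityʳ _
  Σ∈-box-select (suc D) B (y ∷ v) x = begin
    Σ∈ (box (suc D) B) (λ u → [ does ((y ∷ v) ≟ᵛ u) ]· x)                ≈⟨ Σ∈-box-suc D B _ ⟩
    Σ≤ B (λ z → Σ∈ (box D B) (λ u → [ (y ≡ᵇ z) ∧ does (v ≟ᵛ u) ]· x))  ≈⟨ Σ≤-cong B (λ z _ → first-entry z) ⟩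
    Σ≤ B (λ z → [ y ≡ᵇ z ]· [ bounded B v ]· x)                         ≈⟨ Σ≤-select B y _ ⟩
    [ y ≤ᵇ B ]· [ bounded B v ]· x                                       ≈⟨ []·-∧ (y ≤ᵇ B) (bounded B v) x ⟨
    [ bounded B (y ∷ v) ]· x                                             ∎
    where
    first-entry : ∀ z → Σ∈ (box D B) (λ u → [ (y ≡ᵇ z) ∧ does (v ≟ᵛ u) ]· x) ≈ [ y ≡ᵇ z ]· [ bounded B v ]· x
    first-entry z = begin
      Σ∈ (box D B) (λ u → [ (y ≡ᵇ z) ∧ does (v ≟ᵛ u) ]· x)  ≈⟨ Σ∈-cong (box D B) (λ u → []·-∧ (y ≡ᵇ z) _ x) ⟩
      Σ∈ (box D B) (λ u → [ y ≡ᵇ z ]· [ does (v ≟ᵛ u) ]· x) ≈⟨ []·-Σ∈ (y ≡ᵇ z) (box D B) _ ⟨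
      [ y ≡ᵇ z ]· Σ∈ (box D B) (λ u → [ does (v ≟ᵛ u) ]· x) ≈⟨ []·-cong (y ≡ᵇ z) (Σ∈-box-select D B v x) ⟩
      [ y ≡ᵇ z ]· [ bounded B v ]· x                         ∎

module PowerExpansion {c ℓ} (R : CommutativeRing c ℓ) where
  open CommutativeRing R hiding (zero)
  open FiniteSums R
  open PowerSeries R
  open import Algebra.Properties.CommutativeSemigroup *-commutativeSemigroup
    using () renaming (interchange to *-interchange)
  open BoxSums R
  open Multinomial
  open TupleStatistics using ([m+n]∸[o+p]≡[m∸o]+[n∸p])
  open import Relation.Binary.Reasoning.Setoid setoid
  open import Algebra.Solver.CommutativeMonoid *-commutativeMonoid using (solve; _⊕_; _⊜_)

  Gapped : ℕ → S → Set ℓ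
  Gapped i w = ∀ j → 2 ≤ j → j ≤ i → w j ≈ 0#

  -- The term of (w ^ₛ k) indexed by ℓ, where ℓ_p counts the factors w_{i+p} x^{i+p}
  -- and the remaining k - |ℓ| factors are w₁ x.
  expansionTerm : S → ℕ → ℕ → ∀ {D} → Vec ℕ D → Carrier
  expansionTerm w i k ℓ = (w 1 ^ (k ∸ ∣ ℓ ∣) * fromℕ R (binomialProduct k ℓ)) * qProd R w i ℓ

  powerExpansion : S → (i k t D B : ℕ) → Carrier
  powerExpansion w i k t D B = Σ∈ (box D B) (λ ℓ → [ weighted i ℓ ≡ᵇ t ]· expansionTerm w i k ℓ)

  ^ₛ-coeff-gapped : ∀ {w} → w 0 ≈ 0# → ∀ k t → Gapped (suc t) w → (w ^ₛ k) (k ℕ.+ t) ≈ [ 0 ≡ᵇ t ]· w 1 ^ k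
  ^ₛ-coeff-gapped w₀≈0 zero    zero    gap = refl
  ^ₛ-coeff-gapped w₀≈0 zero    (suc t) gap = refl
  ^ₛ-coeff-gapped {w} w₀≈0 (suc k) t gap = begin
    Σ≤ (suc (k ℕ.+ t)) (λ i → w i * (w ^ₛ k) (suc (k ℕ.+ t) ∸ i))  ≈⟨ Σ≤-cong (suc (k ℕ.+ t)) term≈ ⟩
    Σ≤ (suc (k ℕ.+ t)) (λ i → [ 1 ≡ᵇ i ]· (w 1 * (w ^ₛ k) (k ℕ.+ t))) ≈⟨ Σ≤-select (suc (k ℕ.+ t)) 1 _ ⟩
    w 1 * (w ^ₛ k) (k ℕ.+ t)                                      ≈⟨ *-congˡ (^ₛ-coeff-gapped w₀≈0 k t gap) ⟩
    w 1 * [ 0 ≡ᵇ t ]· w 1 ^ k                                     ≈⟨ []·-*ˡ (0 ≡ᵇ t) _ _ ⟩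
    [ 0 ≡ᵇ t ]· w 1 ^ suc k                                       ∎
    where
    k+t∸i<k : ∀ i → i ≤ k ℕ.+ t → t < i → (k ℕ.+ t) ∸ i < k
    k+t∸i<k i i≤k+t t<i = ℕₚ.+-cancelʳ-< i ((k ℕ.+ t) ∸ i) k
      (≡.subst (_< k ℕ.+ i) (≡.sym (ℕₚ.m∸n+n≡m i≤k+t)) (ℕₚ.+-monoʳ-< k t<i))
    term≈ : ∀ i → i ≤ suc (k ℕ.+ t) →
            w i * (w ^ₛ k) (suc (k ℕ.+ t) ∸ i) ≈ [ 1 ≡ᵇ i ]· (w 1 * (w ^ₛ k) (k ℕ.+ t))
    term≈ zero          _   = trans (*-congʳ w₀≈0) (zeroˡ _)
    term≈ (suc zero)    _   = refl
    term≈ (suc (suc j)) 2+j≤ with suc (suc j) ℕ.≤? suc t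
    ... | yes 2+j≤1+t = trans (*-congʳ (gap (suc (suc j)) (s≤s (s≤s z≤n)) 2+j≤1+t)) (zeroˡ _)
    ... | no  2+j≰1+t = trans (*-congˡ (^ₛ-vanishes-below w₀≈0 k _
                          (k+t∸i<k (suc j) (ℕ.s≤s⁻¹ 2+j≤) (ℕ.s≤s⁻¹ (ℕₚ.≰⇒> 2+j≰1+t))))) (zeroʳ _)

  cutAt : ℕ → S → S
  cutAt d w j = [ not (d ≡ᵇ j) ]· w j

  split-at : ∀ d w → w ≋ monomial (w d) d +ₛ cutAt d w
  split-at d w j = go (d ℕ.≟ j)
    where
    go : (d≟j : Dec (d ≡ j)) → w j ≈ [ does d≟j ]· w d + [ not (does d≟j) ]· w j
    go (yes ≡.refl) = sym (+-identityʳ _)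
    go (no _)       = sym (+-identityˡ _)

  cutAt-gapped : ∀ {i w} → Gapped i w → Gapped (suc i) (cutAt (suc i) w)
  cutAt-gapped {i} {w} gap j 2≤j j≤1+i = go (suc i ℕ.≟ j)
    where
    go : (1+i≟j : Dec (suc i ≡ j)) → [ not (does 1+i≟j) ]· w j ≈ 0#
    go (yes _)    = refl
    go (no 1+i≢j) = gap j 2≤j (ℕ.s≤s⁻¹ (ℕₚ.≤∧≢⇒< j≤1+i (λ e → 1+i≢j (≡.sym e))))

  cutAt-agrees : ∀ d w j → d < j → cutAt d w j ≈ w j
  cutAt-agrees d w j d<j = go (d ℕ.≟ j)
    where
    go : (d≟j : Dec (d ≡ j)) → [ not (does d≟j) ]· w j ≈ w j
    go (yes ≡.refl) = ⊥-elim (ℕₚ.n≮n _ d<j)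
    go (no _)       = refl

  qProd-cong : ∀ {D} (a b : S) p (v : Vec ℕ D) → (∀ j → p < j → a j ≈ b j) → qProd R a p v ≈ qProd R b p v
  qProd-cong a b p []      a≈b = refl
  qProd-cong a b p (x ∷ v) a≈b =
    *-cong (^-cong x (a≈b (suc p) ℕₚ.≤-refl)) (qProd-cong a b (suc p) v λ j p+1<j → a≈b j (ℕₚ.<-trans (ℕₚ.n<1+n p) p+1<j))

  qProd-zipWith+ : ∀ {D} (a : S) p (u v : Vec ℕ D) →
                   qProd R a p (Vec.zipWith ℕ._+_ u v) ≈ qProd R a p u * qProd R a p v
  qProd-zipWith+ a p []      []      = sym (*-identityˡ _)
  qProd-zipWith+ a p (x ∷ u) (y ∷ v) =
    trans (*-cong (^-+ (a (suc p)) x y) (qProd-zipWith+ a (suc p) u v)) (*-interchange _ _ _ _)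

  qProd-replicate0 : ∀ D (a : S) p → qProd R a p (Vec.replicate D 0) ≈ 1#
  qProd-replicate0 zero    a p = refl
  qProd-replicate0 (suc D) a p = trans (*-identityˡ _) (qProd-replicate0 D a (suc p))

  -- After taking y factors of degree i + 1 out of the index k + t, the remaining k - y factors
  -- must cover degree (k - y) + (t - i y); a negative excess t - i y leaves a vanishing coefficient.
  ^ₛ-coeff-reindex : ∀ {h} → h 0 ≈ 0# → ∀ k t y i x → y ≤ k →
                     [ y ℕ.* suc i ≤ᵇ k ℕ.+ t ]· (x * (h ^ₛ (k ∸ y)) ((k ℕ.+ t) ∸ y ℕ.* suc i))
                     ≈ [ i ℕ.* y ≤ᵇ t ]· (x * (h ^ₛ (k ∸ y)) ((k ∸ y) ℕ.+ (t ∸ i ℕ.* y)))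
  ^ₛ-coeff-reindex {h} h₀≈0 k t y i x y≤k
    rewrite ≡.trans (ℕₚ.*-suc y i) (≡.cong (y ℕ.+_) (ℕₚ.*-comm y i)) =
    go (i ℕ.* y ℕ.≤? t) (y ℕ.+ i ℕ.* y ℕ.≤? k ℕ.+ t)
    where
    e = i ℕ.* y
    go : (e≤?t : Dec (e ≤ t)) (y+e≤?k+t : Dec (y ℕ.+ e ≤ k ℕ.+ t)) →
         [ does y+e≤?k+t ]· (x * (h ^ₛ (k ∸ y)) ((k ℕ.+ t) ∸ (y ℕ.+ e)))
         ≈ [ does e≤?t ]· (x * (h ^ₛ (k ∸ y)) ((k ∸ y) ℕ.+ (t ∸ e)))
    go (yes e≤t) (yes _)    = reflexive (≡.cong (λ z → x * (h ^ₛ (k ∸ y)) z)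
                                ([m+n]∸[o+p]≡[m∸o]+[n∸p] k t y e y≤k e≤t))
    go (yes e≤t) (no y+e≰)  = ⊥-elim (y+e≰ (ℕₚ.+-mono-≤ y≤k e≤t))
    go (no e≰t)  (yes y+e≤) = trans (*-congˡ (^ₛ-vanishes-below h₀≈0 (k ∸ y) _ index<k∸y)) (zeroʳ _)
      where
      e≤k∸y+t : e ≤ (k ∸ y) ℕ.+ t
      e≤k∸y+t = ≡.subst (e ≤_) (ℕₚ.+-∸-comm t y≤k)
                  (≡.subst (_≤ (k ℕ.+ t) ∸ y) (ℕₚ.m+n∸m≡n y e) (ℕₚ.∸-monoˡ-≤ y y+e≤))
      index<k∸y : (k ℕ.+ t) ∸ (y ℕ.+ e) < k ∸ y
      index<k∸y = ≡.subst (_< k ∸ y)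
        (≡.trans (≡.cong (_∸ e) (≡.sym (ℕₚ.+-∸-comm t y≤k))) (ℕₚ.∸-+-assoc (k ℕ.+ t) y e))
        (≡.subst ((k ∸ y ℕ.+ t) ∸ e <_) (ℕₚ.m+n∸n≡m (k ∸ y) t)
          (ℕₚ.∸-monoʳ-< {k ∸ y ℕ.+ t} {e} {t} (ℕₚ.≰⇒> e≰t) e≤k∸y+t))
    go (no _)    (no _)     = refl

  monomial-^ₛ-*ₛ-coeff : ∀ {h} → h 0 ≈ 0# → ∀ α i k t y → y ≤ k →
    (monomial α (suc i) ^ₛ y *ₛ h ^ₛ (k ∸ y)) (k ℕ.+ t)
    ≈ [ i ℕ.* y ≤ᵇ t ]· (α ^ y * (h ^ₛ (k ∸ y)) ((k ∸ y) ℕ.+ (t ∸ i ℕ.* y)))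
  monomial-^ₛ-*ₛ-coeff {h} h₀≈0 α i k t y y≤k = begin
    (monomial α (suc i) ^ₛ y *ₛ h ^ₛ (k ∸ y)) (k ℕ.+ t)
      ≈⟨ *ₛ-congʳ (h ^ₛ (k ∸ y)) (monomial-^ₛ α (suc i) y) (k ℕ.+ t) ⟩
    (monomial (α ^ y) (y ℕ.* suc i) *ₛ h ^ₛ (k ∸ y)) (k ℕ.+ t)
      ≈⟨ monomial-*ₛ (α ^ y) (y ℕ.* suc i) (h ^ₛ (k ∸ y)) (k ℕ.+ t) ⟩
    [ y ℕ.* suc i ≤ᵇ k ℕ.+ t ]· (α ^ y * (h ^ₛ (k ∸ y)) ((k ℕ.+ t) ∸ y ℕ.* suc i))
      ≈⟨ ^ₛ-coeff-reindex h₀≈0 k t y i (α ^ y) y≤k ⟩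
    [ i ℕ.* y ≤ᵇ t ]· (α ^ y * (h ^ₛ (k ∸ y)) ((k ∸ y) ℕ.+ (t ∸ i ℕ.* y))) ∎

  expansionTerm-∷ : ∀ {D} w w′ i k y (v : Vec ℕ D) → w′ 1 ≈ w 1 → qProd R w′ (suc i) v ≈ qProd R w (suc i) v →
    fromℕ R (k C y) * (w (suc i) ^ y * expansionTerm w′ (suc i) (k ∸ y) v) ≈ expansionTerm w i k (y ∷ v)
  expansionTerm-∷ w w′ i k y v w′₁≈w₁ qProd≈ = begin
    kCy * (α * ((w′ 1 ^ (k ∸ y ∸ ∣ v ∣) * P) * qProd R w′ (suc i) v))
      ≈⟨ *-congˡ (*-congˡ (*-cong (*-congʳ (^-cong (k ∸ y ∸ ∣ v ∣) w′₁≈w₁)) qProd≈)) ⟩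
    kCy * (α * ((w 1 ^ (k ∸ y ∸ ∣ v ∣) * P) * qProd R w (suc i) v))
      ≈⟨ regroup kCy α (w 1 ^ (k ∸ y ∸ ∣ v ∣)) P (qProd R w (suc i) v) ⟩
    (w 1 ^ (k ∸ y ∸ ∣ v ∣) * (kCy * P)) * (α * qProd R w (suc i) v)
      ≈⟨ *-congʳ (*-cong (reflexive (≡.cong (w 1 ^_) (ℕₚ.∸-+-assoc k y ∣ v ∣))) (sym (fromℕ-* (k C y) _))) ⟩
    expansionTerm w i k (y ∷ v) ∎
    where
    kCy = fromℕ R (k C y)
    α = w (suc i) ^ y
    P = fromℕ R (binomialProduct (k ∸ y) v)
    regroup : ∀ c a e m q → c * (a * ((e * m) * q)) ≈ (e * (c * m)) * (a * q)
    regroup = solve 5 (λ c a e m q → c ⊕ (a ⊕ ((e ⊕ m) ⊕ q)) ⊜ (e ⊕ (c ⊕ m)) ⊕ (a ⊕ q)) refl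

  powerExpansion-∷ : ∀ D B w w′ i k t y → w′ 1 ≈ w 1 → (∀ j → suc i < j → w′ j ≈ w j) →
    fromℕ R (k C y) * [ i ℕ.* y ≤ᵇ t ]· (w (suc i) ^ y * powerExpansion w′ (suc i) (k ∸ y) (t ∸ i ℕ.* y) D B)
    ≈ Σ∈ (box D B) (λ v → [ weighted i (y ∷ v) ≡ᵇ t ]· expansionTerm w i k (y ∷ v))
  powerExpansion-∷ D B w w′ i k t y w′₁≈w₁ w′≈w = begin
    kCy * [ b ]· (α * Σ∈ (box D B) (λ v → [ b′ v ]· X v))   ≈⟨ *-congˡ ([]·-cong b (*-distribˡ-Σ∈ (box D B) α _)) ⟩
    kCy * [ b ]· Σ∈ (box D B) (λ v → α * [ b′ v ]· X v)     ≈⟨ *-congˡ ([]·-Σ∈ b (box D B) _) ⟩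
    kCy * Σ∈ (box D B) (λ v → [ b ]· (α * [ b′ v ]· X v))   ≈⟨ *-distribˡ-Σ∈ (box D B) kCy _ ⟩
    Σ∈ (box D B) (λ v → kCy * [ b ]· (α * [ b′ v ]· X v))   ≈⟨ Σ∈-cong (box D B) term≈ ⟩
    Σ∈ (box D B) (λ v → [ weighted i (y ∷ v) ≡ᵇ t ]· expansionTerm w i k (y ∷ v)) ∎
    where
    kCy = fromℕ R (k C y)
    α = w (suc i) ^ y
    b = i ℕ.* y ≤ᵇ t
    b′ : Vec ℕ D → Bool
    b′ v = weighted (suc i) v ≡ᵇ t ∸ i ℕ.* y
    X : Vec ℕ D → Carrier
    X v = expansionTerm w′ (suc i) (k ∸ y) v
    term≈ : ∀ v → kCy * [ b ]· (α * [ b′ v ]· X v) ≈ [ weighted i (y ∷ v) ≡ᵇ t ]· expansionTerm w i k (y ∷ v)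
    term≈ v = begin
      kCy * [ b ]· (α * [ b′ v ]· X v)                 ≈⟨ *-congˡ ([]·-cong b ([]·-*ˡ (b′ v) α (X v))) ⟩
      kCy * [ b ]· [ b′ v ]· (α * X v)                 ≈⟨ *-congˡ ([]·-≤-≡∸ (i ℕ.* y) (weighted (suc i) v) t _) ⟩
      kCy * [ weighted i (y ∷ v) ≡ᵇ t ]· (α * X v)     ≈⟨ []·-*ˡ (weighted i (y ∷ v) ≡ᵇ t) kCy _ ⟩
      [ weighted i (y ∷ v) ≡ᵇ t ]· (kCy * (α * X v))   ≈⟨ []·-cong (weighted i (y ∷ v) ≡ᵇ t)
                                                            (expansionTerm-∷ w w′ i k y v w′₁≈w₁ (qProd-cong w′ w (suc i) v w′≈w)) ⟩
      [ weighted i (y ∷ v) ≡ᵇ t ]· expansionTerm w i k (y ∷ v) ∎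

  -- Induction on D peels off the lowest term w_{i+2} x^{i+2} beyond the gap and expands by the
  -- binomial theorem; what remains is gapped one degree further.
  ^ₛ-coeff-expansion : ∀ D i {w} k t B → w 0 ≈ 0# → Gapped (suc i) w → t < suc i ℕ.+ D → t ≤ B →
                       (w ^ₛ k) (k ℕ.+ t) ≈ powerExpansion w (suc i) k t D B
  ^ₛ-coeff-expansion zero i {w} k t B w₀≈0 gap t<1+i+0 _ = begin
    (w ^ₛ k) (k ℕ.+ t)                          ≈⟨ ^ₛ-coeff-gapped w₀≈0 k t gap′ ⟩
    [ 0 ≡ᵇ t ]· w 1 ^ k                         ≈⟨ []·-cong (0 ≡ᵇ t) (sym (trans (*-identityʳ _)
                                                     (trans (*-congˡ (+-identityʳ _)) (*-identityʳ _)))) ⟩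
    [ 0 ≡ᵇ t ]· expansionTerm w (suc i) k []    ≈⟨ +-identityʳ _ ⟨
    powerExpansion w (suc i) k t zero B         ∎
    where
    gap′ : Gapped (suc t) w
    gap′ j 2≤j j≤1+t = gap j 2≤j (ℕₚ.≤-trans j≤1+t (≡.subst (suc t ≤_) (ℕₚ.+-identityʳ (suc i)) t<1+i+0))
  ^ₛ-coeff-expansion (suc D) i {w} k t B w₀≈0 gap t<1+i+1+D t≤B = begin
    (w ^ₛ k) (k ℕ.+ t)                 ≈⟨ ^ₛ-cong k (split-at (suc (suc i)) w) (k ℕ.+ t) ⟩
    ((a +ₛ w′) ^ₛ k) (k ℕ.+ t)         ≈⟨ binomial-coeff a w′ k (k ℕ.+ t) ⟩
    Σ≤ k (λ y → fromℕ R (k C y) * (a ^ₛ y *ₛ w′ ^ₛ (k ∸ y)) (k ℕ.+ t))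
                                       ≈⟨ Σ≤-cong k (λ y y≤k → *-congˡ (choose y y≤k)) ⟩
    Σ≤ k H                             ≈⟨ Σ≤-extend₂ k B H≈F H≈0 F≈0 ⟩
    Σ≤ B F                             ≈⟨ Σ∈-box-suc D B _ ⟨
    powerExpansion w (suc i) k t (suc D) B ∎
    where
    α = w (suc (suc i))
    a = monomial α (suc (suc i))
    w′ = cutAt (suc (suc i)) w
    H F : ℕ → Carrier
    H y = fromℕ R (k C y) * [ suc i ℕ.* y ≤ᵇ t ]·
            (α ^ y * powerExpansion w′ (suc (suc i)) (k ∸ y) (t ∸ suc i ℕ.* y) D B)
    F y = Σ∈ (box D B) (λ v → [ weighted (suc i) (y ∷ v) ≡ᵇ t ]· expansionTerm w (suc i) k (y ∷ v))

    ih : ∀ k′ t′ → t′ ≤ t → (w′ ^ₛ k′) (k′ ℕ.+ t′) ≈ powerExpansion w′ (suc (suc i)) k′ t′ D B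
    ih k′ t′ t′≤t = ^ₛ-coeff-expansion D (suc i) k′ t′ B w₀≈0 (cutAt-gapped gap)
      (≡.subst (t′ <_) (ℕₚ.+-suc (suc i) D) (ℕₚ.≤-<-trans t′≤t t<1+i+1+D)) (ℕₚ.≤-trans t′≤t t≤B)

    choose : ∀ y → y ≤ k → (a ^ₛ y *ₛ w′ ^ₛ (k ∸ y)) (k ℕ.+ t)
             ≈ [ suc i ℕ.* y ≤ᵇ t ]· (α ^ y * powerExpansion w′ (suc (suc i)) (k ∸ y) (t ∸ suc i ℕ.* y) D B)
    choose y y≤k = trans (monomial-^ₛ-*ₛ-coeff w₀≈0 α (suc i) k t y y≤k)
                         ([]·-cong (suc i ℕ.* y ≤ᵇ t) (*-congˡ (ih (k ∸ y) (t ∸ suc i ℕ.* y) (ℕₚ.m∸n≤m t (suc i ℕ.* y)))))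

    H≈F : ∀ y → H y ≈ F y
    H≈F y = powerExpansion-∷ D B w w′ (suc i) k t y refl (cutAt-agrees (suc (suc i)) w)

    H≈0 : ∀ y → k < y → H y ≈ 0#
    H≈0 y k<y = trans (*-congʳ (reflexive (≡.cong (fromℕ R) (k>n⇒nCk≡0 k<y)))) (zeroˡ _)

    F≈0 : ∀ y → B < y → F y ≈ 0#
    F≈0 y B<y = Σ∈-zero (box D B) λ v →
      []·-no (weighted (suc i) (y ∷ v) ℕ.≟ t) _ (λ e → ℕₚ.<⇒≢ (t<weight v) (≡.sym e))
      where
      t<weight : ∀ v → t < weighted (suc i) (y ∷ v)
      t<weight v = ℕₚ.<-≤-trans (ℕₚ.≤-<-trans t≤B B<y)
                     (ℕₚ.≤-trans (ℕₚ.m≤m+n y (i ℕ.* y)) (ℕₚ.m≤m+n (suc i ℕ.* y) _))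

module Iterates {c ℓ} (R : CommutativeRing c ℓ) (q : ℕ → CommutativeRing.Carrier R) where
  open CommutativeRing R hiding (zero)
  open FiniteSums R
  open PowerSeries R
  open BoxSums R
  open PowerExpansion R
  open Multinomial
  open TupleStatistics
  open import Relation.Binary.Reasoning.Setoid setoid
  open import Algebra.Solver.CommutativeMonoid *-commutativeMonoid using (solve; _⊕_; _⊜_)

  f : S
  f = seriesOf R q

  qProds : ∀ {D} → List (Vec ℕ D) → Carrier
  qProds []       = 1#
  qProds (v ∷ ts) = qProd R q 1 v * qProds ts

  tupleTerm : ∀ {D} → ℕ → List (Vec ℕ D) → Carrier
  tupleTerm acc ts = (q 1 ^ qExponent acc ts * fromℕ R (multProd acc ts)) * qProds ts

  iterateExpansion : (s acc m D B : ℕ) → Carrier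
  iterateExpansion s acc m D B = Σ∈ (tuplesOf s (box D B)) (λ ts → [ Σ⟨ ts ⟩ ≡ᵇ m ]· tupleTerm acc ts)

  iterS-vanishes-at-0 : ∀ s → iterS R f s 0 ≈ 0#
  iterS-vanishes-at-0 zero    = refl
  iterS-vanishes-at-0 (suc s) = zeroˡ _

  ^-*fromℕ-cong : ∀ x {a b} N → (N ≢ 0 → a ≡ b) → x ^ a * fromℕ R N ≈ x ^ b * fromℕ R N
  ^-*fromℕ-cong x zero    a≡b = trans (zeroʳ _) (sym (zeroʳ _))
  ^-*fromℕ-cong x (suc N) a≡b = reflexive (≡.cong (λ e → x ^ e * fromℕ R (suc N)) (a≡b λ ()))

  tupleTerm-∷ : ∀ {D} k (v : Vec ℕ D) ts →
                expansionTerm f 1 k v * tupleTerm (k ℕ.+ ⟨ v ⟩) ts ≈ tupleTerm k (v ∷ ts)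
  tupleTerm-∷ k v ts = begin
    ((q 1 ^ (k ∸ ∣ v ∣) * fromℕ R bp) * qProd R f 1 v) * ((q 1 ^ e * fromℕ R mp) * qProds ts)
      ≈⟨ regroup _ _ _ _ _ _ ⟩
    (q 1 ^ (k ∸ ∣ v ∣) * q 1 ^ e) * (fromℕ R bp * fromℕ R mp) * (qProd R f 1 v * qProds ts)
      ≈⟨ *-cong (*-cong (sym (^-+ (q 1) (k ∸ ∣ v ∣) e)) (sym (fromℕ-* bp mp)))
                (*-congʳ (qProd-cong f q 1 v λ { (suc j) _ → refl })) ⟩
    (q 1 ^ ((k ∸ ∣ v ∣) ℕ.+ e) * fromℕ R (bp ℕ.* mp)) * qProds (v ∷ ts)
      ≈⟨ *-congʳ (reflexive (≡.cong (λ n → q 1 ^ ((k ∸ ∣ v ∣) ℕ.+ e) * fromℕ R (n ℕ.* mp))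
                                     (≡.sym (multinom≡binomialProduct k v)))) ⟩
    (q 1 ^ ((k ∸ ∣ v ∣) ℕ.+ e) * fromℕ R (multProd k (v ∷ ts))) * qProds (v ∷ ts)
      ≈⟨ *-congʳ (^-*fromℕ-cong (q 1) (multProd k (v ∷ ts)) λ ≢0 → ≡.sym (qExponent-∷ k v ts ≢0)) ⟩
    tupleTerm k (v ∷ ts) ∎
    where
    bp = binomialProduct k v
    mp = multProd (k ℕ.+ ⟨ v ⟩) ts
    e = qExponent (k ℕ.+ ⟨ v ⟩) ts
    regroup : ∀ a m p b n r → ((a * m) * p) * ((b * n) * r) ≈ ((a * b) * (m * n)) * (p * r)
    regroup = solve 6 (λ a m p b n r → ((a ⊕ m) ⊕ p) ⊕ ((b ⊕ n) ⊕ r) ⊜ ((a ⊕ b) ⊕ (m ⊕ n)) ⊕ (p ⊕ r)) refl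

  iterS-^ₛ-coeff : ∀ s k m D B → m ≤ D → m ≤ B → (iterS R f s ^ₛ k) (k ℕ.+ m) ≈ iterateExpansion s k m D B
  iterS-^ₛ-coeff zero k m D B _ _ = begin
    (xS R ^ₛ k) (k ℕ.+ m)               ≈⟨ ^ₛ-coeff-gapped refl k m x-gapped ⟩
    [ 0 ≡ᵇ m ]· 1# ^ k                  ≈⟨ []·-cong (0 ≡ᵇ m) (trans (1^n≈1 k) (sym (trans (*-identityʳ _)
                                             (trans (*-identityˡ _) (+-identityʳ _))))) ⟩
    [ 0 ≡ᵇ m ]· tupleTerm {D} k []      ≈⟨ +-identityʳ _ ⟨
    iterateExpansion zero k m D B       ∎
    where
    x-gapped : Gapped (suc m) (xS R)
    x-gapped (suc (suc j)) _        _ = refl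
    x-gapped (suc zero)    (s≤s ()) _
  iterS-^ₛ-coeff (suc s) k m D B m≤D m≤B = begin
    ((f ∘ₛ g) ^ₛ k) (k ℕ.+ m)                                   ≈⟨ ^ₛ-∘ₛ (iterS-vanishes-at-0 s) f k (k ℕ.+ m) ⟩
    Σ≤ (k ℕ.+ m) (λ j → (f ^ₛ k) j * (g ^ₛ j) (k ℕ.+ m))       ≈⟨ Σ≤-drop k m _ (λ j j<k →
                                                                     trans (*-congʳ (^ₛ-vanishes-below refl k j j<k)) (zeroˡ _)) ⟩
    Σ≤ m (λ t → (f ^ₛ k) (k ℕ.+ t) * (g ^ₛ (k ℕ.+ t)) (k ℕ.+ m)) ≈⟨ Σ≤-cong m step ⟩
    Σ≤ m (λ t → Σ∈ (box D B) (λ v → [ ⟨ v ⟩ ≡ᵇ t ]· Y v))       ≈⟨ Σ≤-Σ∈ (box D B) m _ ⟩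
    Σ∈ (box D B) (λ v → Σ≤ m (λ t → [ ⟨ v ⟩ ≡ᵇ t ]· Y v))       ≈⟨ Σ∈-cong (box D B) (λ v → Σ≤-select m ⟨ v ⟩ (λ _ → Y v)) ⟩
    Σ∈ (box D B) (λ v → [ ⟨ v ⟩ ≤ᵇ m ]· Y v)                    ≈⟨ Σ∈-cong (box D B) prepend ⟩
    Σ∈ (box D B) (λ v → Σ∈ TS (λ ts → F (v ∷ ts)))              ≈⟨ Σ∈-tuplesOf-suc s (box D B) F ⟨
    iterateExpansion (suc s) k m D B                            ∎
    where
    g = iterS R f s
    TS = tuplesOf s (box D B)
    Y : Vec ℕ D → Carrier
    Y v = expansionTerm f 1 k v * iterateExpansion s (k ℕ.+ ⟨ v ⟩) (m ∸ ⟨ v ⟩) D B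
    F : List (Vec ℕ D) → Carrier
    F ts = [ Σ⟨ ts ⟩ ≡ᵇ m ]· tupleTerm k ts

    step : ∀ t → t ≤ m → (f ^ₛ k) (k ℕ.+ t) * (g ^ₛ (k ℕ.+ t)) (k ℕ.+ m) ≈ Σ∈ (box D B) (λ v → [ ⟨ v ⟩ ≡ᵇ t ]· Y v)
    step t t≤m = begin
      (f ^ₛ k) (k ℕ.+ t) * (g ^ₛ (k ℕ.+ t)) (k ℕ.+ m)
        ≈⟨ *-cong (^ₛ-coeff-expansion D 0 k t B refl (λ { j (s≤s (s≤s _)) (s≤s ()) })
                    (s≤s (ℕₚ.≤-trans t≤m m≤D)) (ℕₚ.≤-trans t≤m m≤B))
                  (trans (reflexive (≡.cong (g ^ₛ (k ℕ.+ t)) k+m≡k+t+[m∸t]))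
                         (iterS-^ₛ-coeff s (k ℕ.+ t) (m ∸ t) D B (ℕₚ.≤-trans (ℕₚ.m∸n≤m m t) m≤D)
                                                                 (ℕₚ.≤-trans (ℕₚ.m∸n≤m m t) m≤B))) ⟩
      powerExpansion f 1 k t D B * iterateExpansion s (k ℕ.+ t) (m ∸ t) D B
        ≈⟨ *-distribʳ-Σ∈ (box D B) _ _ ⟩
      Σ∈ (box D B) (λ v → [ ⟨ v ⟩ ≡ᵇ t ]· expansionTerm f 1 k v * iterateExpansion s (k ℕ.+ t) (m ∸ t) D B)
        ≈⟨ Σ∈-cong (box D B) (λ v → trans ([]·-*ʳ (⟨ v ⟩ ≡ᵇ t) _ _) ([]·-cong-dec (⟨ v ⟩ ℕ.≟ t)
             λ ⟨v⟩≡t → reflexive (≡.cong (λ z → expansionTerm f 1 k v * iterateExpansion s (k ℕ.+ z) (m ∸ z) D B)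
                                          (≡.sym ⟨v⟩≡t)))) ⟩
      Σ∈ (box D B) (λ v → [ ⟨ v ⟩ ≡ᵇ t ]· Y v) ∎
      where
      k+m≡k+t+[m∸t] : k ℕ.+ m ≡ (k ℕ.+ t) ℕ.+ (m ∸ t)
      k+m≡k+t+[m∸t] = ≡.trans (≡.cong (k ℕ.+_) (≡.sym (ℕₚ.m+[n∸m]≡n t≤m))) (≡.sym (ℕₚ.+-assoc k t (m ∸ t)))

    prepend : ∀ v → [ ⟨ v ⟩ ≤ᵇ m ]· Y v ≈ Σ∈ TS (λ ts → F (v ∷ ts))
    prepend v = begin
      [ ⟨ v ⟩ ≤ᵇ m ]· (E * Σ∈ TS (λ ts → [ Σ⟨ ts ⟩ ≡ᵇ m ∸ ⟨ v ⟩ ]· tupleTerm (k ℕ.+ ⟨ v ⟩) ts))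
        ≈⟨ []·-cong (⟨ v ⟩ ≤ᵇ m) (*-distribˡ-Σ∈ TS _ _) ⟩
      [ ⟨ v ⟩ ≤ᵇ m ]· Σ∈ TS (λ ts → E * [ Σ⟨ ts ⟩ ≡ᵇ m ∸ ⟨ v ⟩ ]· tupleTerm (k ℕ.+ ⟨ v ⟩) ts)
        ≈⟨ []·-Σ∈ (⟨ v ⟩ ≤ᵇ m) TS _ ⟩
      Σ∈ TS (λ ts → [ ⟨ v ⟩ ≤ᵇ m ]· (E * [ Σ⟨ ts ⟩ ≡ᵇ m ∸ ⟨ v ⟩ ]· tupleTerm (k ℕ.+ ⟨ v ⟩) ts))
        ≈⟨ Σ∈-cong TS (λ ts → begin
             [ ⟨ v ⟩ ≤ᵇ m ]· (E * [ Σ⟨ ts ⟩ ≡ᵇ m ∸ ⟨ v ⟩ ]· tupleTerm (k ℕ.+ ⟨ v ⟩) ts)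
               ≈⟨ []·-cong (⟨ v ⟩ ≤ᵇ m) ([]·-*ˡ (Σ⟨ ts ⟩ ≡ᵇ m ∸ ⟨ v ⟩) _ _) ⟩
             [ ⟨ v ⟩ ≤ᵇ m ]· [ Σ⟨ ts ⟩ ≡ᵇ m ∸ ⟨ v ⟩ ]· (E * tupleTerm (k ℕ.+ ⟨ v ⟩) ts)
               ≈⟨ []·-≤-≡∸ ⟨ v ⟩ Σ⟨ ts ⟩ m _ ⟩
             [ Σ⟨ v ∷ ts ⟩ ≡ᵇ m ]· (E * tupleTerm (k ℕ.+ ⟨ v ⟩) ts)
               ≈⟨ []·-cong (Σ⟨ v ∷ ts ⟩ ≡ᵇ m) (tupleTerm-∷ k v ts) ⟩
             F (v ∷ ts) ∎) ⟩
      Σ∈ TS (λ ts → F (v ∷ ts)) ∎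
      where E = expansionTerm f 1 k v

  qProd-vsum : ∀ D (ts : List (Vec ℕ D)) → qProd R q 1 (vsum ts) ≈ qProds ts
  qProd-vsum D []       = qProd-replicate0 D q 1
  qProd-vsum D (v ∷ ts) = trans (qProd-zipWith+ q 1 v (vsum ts)) (*-congˡ (qProd-vsum D ts))

  decompositionTerm : ∀ {m} (s k : ℕ) → Vec ℕ m → List (Vec ℕ m) → Carrier
  decompositionTerm s k L ts = q 1 ^ ((wsum ts ℕ.+ s ℕ.* k) ∸ ∣ L ∣) * fromℕ R (multProd k ts)

  module _ (s k m : ℕ) where
    private
      TS = tuplesOf s (box m m)

      Z : List (Vec ℕ m) → Carrier
      Z ts = decompositionTerm s k (vsum ts) ts * qProd R q 1 (vsum ts)

      W : List (Vec ℕ m) → Carrier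
      W ts = [ ⟨ vsum ts ⟩ ≡ᵇ m ]· Z ts

    -- A decomposition of L has all parts bounded by |L| ≤ ⟨L⟩ = m, so it already occurs in box m m.
    CL-via-tuples : ∀ L → ⟨ L ⟩ ≡ m → CL R q s k L * qProd R q 1 L
                    ≈ Σ∈ TS (λ ts → [ does (vsum ts ≟ᵛ L) ]· (decompositionTerm s k L ts * qProd R q 1 L))
    CL-via-tuples L ⟨L⟩≡m = begin
      CL R q s k L * qProd R q 1 L
        ≈⟨ *-congʳ (Σ∈-filter (λ ts → vsum ts ≟ᵛ L) (tuplesOf s (box m ∣ L ∣)) _) ⟩
      Σ∈ (tuplesOf s (box m ∣ L ∣)) (λ ts → [ does (vsum ts ≟ᵛ L) ]· decompositionTerm s k L ts) * qProd R q 1 L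
        ≈⟨ *-congʳ (Σ∈-tuplesOf-shrink s m ∣L∣≤m _ unbounded≈0) ⟨
      Σ∈ TS (λ ts → [ does (vsum ts ≟ᵛ L) ]· decompositionTerm s k L ts) * qProd R q 1 L
        ≈⟨ *-distribʳ-Σ∈ TS _ _ ⟩
      Σ∈ TS (λ ts → [ does (vsum ts ≟ᵛ L) ]· decompositionTerm s k L ts * qProd R q 1 L)
        ≈⟨ Σ∈-cong TS (λ ts → []·-*ʳ (does (vsum ts ≟ᵛ L)) _ _) ⟩
      Σ∈ TS (λ ts → [ does (vsum ts ≟ᵛ L) ]· (decompositionTerm s k L ts * qProd R q 1 L)) ∎
      where
      ∣L∣≤m : ∣ L ∣ ≤ m
      ∣L∣≤m = ≡.subst (∣ L ∣ ≤_) ⟨L⟩≡m (∣v∣≤⟨v⟩ L)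
      unbounded≈0 : ∀ ts → allBounded ∣ L ∣ ts ≡ false → [ does (vsum ts ≟ᵛ L) ]· decompositionTerm s k L ts ≈ 0#
      unbounded≈0 ts unbounded = []·-no (vsum ts ≟ᵛ L) (decompositionTerm s k L ts) λ vsum≡L →
        let bounded = allBounded-∣vsum∣ ∣ L ∣ ts (≡.subst (λ u → ∣ vsum ts ∣ ≤ ∣ u ∣) vsum≡L ℕₚ.≤-refl)
        in ≡.subst T (≡.trans (≡.sym bounded) unbounded) tt

    summand-via-tuples : ∀ L → [ ⟨ L ⟩ ≡ᵇ m ]· (CL R q s k L * qProd R q 1 L)
                             ≈ Σ∈ TS (λ ts → [ does (vsum ts ≟ᵛ L) ]· W ts)
    summand-via-tuples L = begin
      [ ⟨ L ⟩ ≡ᵇ m ]· (CL R q s k L * qProd R q 1 L)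
        ≈⟨ []·-cong-dec (⟨ L ⟩ ℕ.≟ m) (CL-via-tuples L) ⟩
      [ ⟨ L ⟩ ≡ᵇ m ]· Σ∈ TS (λ ts → [ does (vsum ts ≟ᵛ L) ]· Zᴸ L ts)
        ≈⟨ []·-Σ∈ (⟨ L ⟩ ≡ᵇ m) TS _ ⟩
      Σ∈ TS (λ ts → [ ⟨ L ⟩ ≡ᵇ m ]· [ does (vsum ts ≟ᵛ L) ]· Zᴸ L ts)
        ≈⟨ Σ∈-cong TS (λ ts → trans ([]·-comm (⟨ L ⟩ ≡ᵇ m) (does (vsum ts ≟ᵛ L)) (Zᴸ L ts))
                                    ([]·-cong-dec (vsum ts ≟ᵛ L) λ vsum≡L →
                                       reflexive (≡.cong (λ u → [ ⟨ u ⟩ ≡ᵇ m ]· Zᴸ u ts) (≡.sym vsum≡L)))) ⟩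
      Σ∈ TS (λ ts → [ does (vsum ts ≟ᵛ L) ]· W ts) ∎
      where
      Zᴸ : Vec ℕ m → List (Vec ℕ m) → Carrier
      Zᴸ L ts = decompositionTerm s k L ts * qProd R q 1 L

    bounded-redundant : ∀ ts → [ bounded m (vsum ts) ]· W ts ≈ W ts
    bounded-redundant ts = trans ([]·-comm (bounded m (vsum ts)) (⟨ vsum ts ⟩ ≡ᵇ m) (Z ts))
      ([]·-cong-dec (⟨ vsum ts ⟩ ℕ.≟ m) λ ⟨vsum⟩≡m → reflexive (≡.cong (λ b → [ b ]· Z ts)
        (bounded-∣∣ m (vsum ts) (≡.subst (∣ vsum ts ∣ ≤_) ⟨vsum⟩≡m (∣v∣≤⟨v⟩ (vsum ts))))))

    W≈summand : ∀ ts → List.length ts ≡ s → W ts ≈ [ Σ⟨ ts ⟩ ≡ᵇ m ]· tupleTerm k ts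
    W≈summand ts length≡s = trans
      (reflexive (≡.cong (λ z → [ z ≡ᵇ m ]· Z ts) (⟨vsum⟩≡Σ⟨⟩ m ts)))
      ([]·-cong (Σ⟨ ts ⟩ ≡ᵇ m) (*-cong (*-congʳ (reflexive (≡.cong (q 1 ^_) exponent≡))) (qProd-vsum m ts)))
      where
      exponent≡ : (wsum ts ℕ.+ s ℕ.* k) ∸ ∣ vsum ts ∣ ≡ qExponent k ts
      exponent≡ = ≡.cong₂ _∸_ (≡.cong (λ z → wsum ts ℕ.+ z ℕ.* k) (≡.sym length≡s)) (∣vsum∣≡Σ∣∣ m ts)

    𝒫-sum≈iterateExpansion : Σ∈ (𝒫 m) (λ L → CL R q s k L * qProd R q 1 L) ≈ iterateExpansion s k m m m
    𝒫-sum≈iterateExpansion = begin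
      Σ∈ (𝒫 m) (λ L → CL R q s k L * qProd R q 1 L)
        ≈⟨ Σ∈-filter (λ v → ⟨ v ⟩ ℕ.≟ m) (box m m) _ ⟩
      Σ∈ (box m m) (λ L → [ ⟨ L ⟩ ≡ᵇ m ]· (CL R q s k L * qProd R q 1 L))
        ≈⟨ Σ∈-cong (box m m) summand-via-tuples ⟩
      Σ∈ (box m m) (λ L → Σ∈ TS (λ ts → [ does (vsum ts ≟ᵛ L) ]· W ts))
        ≈⟨ Σ∈-swap (box m m) TS _ ⟩
      Σ∈ TS (λ ts → Σ∈ (box m m) (λ L → [ does (vsum ts ≟ᵛ L) ]· W ts))
        ≈⟨ Σ∈-cong TS (λ ts → Σ∈-box-select m m (vsum ts) (W ts)) ⟩
      Σ∈ TS (λ ts → [ bounded m (vsum ts) ]· W ts)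
        ≈⟨ Σ∈-cong TS bounded-redundant ⟩
      Σ∈ TS W
        ≈⟨ Σ∈-tuplesOf-cong s (box m m) W≈summand ⟩
      iterateExpansion s k m m m ∎

theorem3 : ∀ {c ℓ} (R : CommutativeRing c ℓ) (q : ℕ → CommutativeRing.Carrier R) →
             ¬ (CommutativeRing._≈_ R (q 1) (CommutativeRing.0# R)) →
             (s n k : ℕ) → k ≤ n →
             CommutativeRing._≈_ R (cCoeff R q s n k) (rhs R q s n k)
theorem3 R q _ s n k k≤n = *-congˡ (begin
  (iterS R f s ^ₛ k) n                                 ≡⟨ ≡.cong (iterS R f s ^ₛ k) (≡.sym (ℕₚ.m+[n∸m]≡n k≤n)) ⟩
  (iterS R f s ^ₛ k) (k ℕ.+ (n ∸ k))                   ≈⟨ iterS-^ₛ-coeff s k (n ∸ k) (n ∸ k) (n ∸ k) ℕₚ.≤-refl ℕₚ.≤-refl ⟩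
  iterateExpansion s k (n ∸ k) (n ∸ k) (n ∸ k)         ≈⟨ 𝒫-sum≈iterateExpansion s k (n ∸ k) ⟨
  FiniteSums.Σ∈ R (𝒫 (n ∸ k)) (λ L → CL R q s k L * qProd R q 1 L) ∎)
  where
  open CommutativeRing R
  open PowerSeries R using (_^ₛ_)
  open Iterates R q
  open import Relation.Binary.Reasoning.Setoid setoid
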